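{- Let $\boldsymbol\lambda=((\lambda_1),\dots,(\lambda_k))$ be a $k$-tuple of one-part partitions, and let $\boldsymbol\nu=((\nu_1),\dots,(\nu_k))$ be a rearrangement of it, i.e. $\nu_i=\lambda_{\sigma(i)}$ for some permutation $\sigma$ of $\{1,\dots,k\}$. Then for all $n,m\ge0$, $$\mathcal L^S_{\boldsymbol\lambda}(X_n;Y_m;t)=t^{\mathrm{Inv}(\boldsymbol\lambda)-\mathrm{Inv}(\boldsymbol\nu)}\,\mathcal L^S_{\boldsymbol\nu}(X_n;Y_m;t),$$ where $\mathrm{Inv}((\rho_1),\dots,(\rho_k))=\#\{a<b:\rho_a>\rho_b\}$.
   Context: Fix an integer $k\ge1$ (colours $1,\dots,k$) and an indeterminate $t$. For $\mathbf I\in\{0,1\}^k$ let $|\mathbf I|=\sum_cI_c$, and for $\mathbf I,\mathbf J\in\mathbb Z^k$ let $\varphi(\mathbf I,\mathbf J)=\sum_{1\le c<d\le k}I_cJ_d$. A vertex is a unit square whose bottom, left, top, right edges carry labels $\mathbf I,\mathbf J,\mathbf K,\mathbf L\in\{0,1\}^k$; $I_c=1$ means a path of colour $c$ uses that edge (paths move up and right). White weight: $W_x(\mathbf I,\mathbf J,\mathbf K,\mathbf L)=\mathbf 1_{\mathbf I+\mathbf J=\mathbf K+\mathbf L}\prod_c\mathbf 1_{I_c+J_c\ne2}\,x^{|\mathbf L|}t^{\varphi(\mathbf L,\mathbf I+\mathbf J)}$; purple weight: $P_x(\mathbf I,\mathbf J,\mathbf K,\mathbf L)=\mathbf 1_{\mathbf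 I+\mathbf J=\mathbf K+\mathbf L}\prod_c\mathbf 1_{K_c\ge J_c}\,x^{|\mathbf L|}t^{\varphi(\mathbf L,\mathbf K-\mathbf J)}$. For a $k$-tuple $\boldsymbol\lambda$ of one-part partitions, $\mathcal L^S_{\boldsymbol\lambda}(X_n;Y_m;t)$ is the partition function of the lattice with $n+m$ rows and columns $-1,0,1,\dots,N$ ($N$ large): rows $1,\dots,n$ from the bottom white with parameters $x_1,\dots,x_n$, rows $n+1,\dots,n+m$ purple with parameters $y_1,\dots,y_m$; every colour enters at the bottom of column $-1$, the top boundary edge of column $c$ carries colour $a$ iff $c=\lambda_a-1$, left/right boundaries empty; it is the sum over labellings of internal edges of the product of the vertex weights. -}

module Defs where

open import Data.Nat using (ℕ; zero; suc; _∸_; _≡ᵇ_; _≤ᵇ_; _<ᵇ_)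
  renaming (_+_ to _+ℕ_; _*_ to _*ℕ_)
open import Data.Bool using (Bool; true; false; _∧_; not; if_then_else_)
open import Data.Vec using (Vec; []; _∷_; replicate; zipWith; foldr′)
  renaming (map to mapV)
open import Data.List using (List; []; _∷_; _++_; concatMap) renaming (map to mapL)
open import Data.Fin using (Fin; toℕ)
open import Algebra.Bundles using (CommutativeRing)

-- Edge labels: a label is an element of {0,1}^k, encoded as Vec Bool k
-- (true at position c  <->  a path of colour c uses the edge).

Label : ℕ → Set
Label k = Vec Bool k

b2n : Bool → ℕ
b2n true  = 1
b2n false = 0

toN : ∀ {k} → Label k → Vec ℕ k
toN = mapV b2n

allVecs : ∀ {a} {A : Set a} → List A → (w : ℕ) → List (Vec A w)
allVecs xs zero    = [] ∷ []
allVecs xs (suc w) = concatMap (λ v → mapL (_∷ v) xs) (allVecs xs w)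

allLabels : (k : ℕ) → List (Label k)
allLabels k = allVecs (false ∷ true ∷ []) k

sumV : ∀ {k} → Vec ℕ k → ℕ
sumV = foldr′ _+ℕ_ 0

size : ∀ {k} → Label k → ℕ
size I = sumV (toN I)

-- φ(I,J) = Σ_{c<d} I_c J_d
φ : ∀ {k} → Vec ℕ k → Vec ℕ k → ℕ
φ []      []      = 0
φ (i ∷ I) (j ∷ J) = i *ℕ sumV J +ℕ φ I J

eqV : ∀ {k} → Vec ℕ k → Vec ℕ k → Bool
eqV []      []      = true
eqV (i ∷ I) (j ∷ J) = (i ≡ᵇ j) ∧ eqV I J

eqL : ∀ {k} → Label k → Label k → Bool
eqL I J = eqV (toN I) (toN J)

allB : ∀ {k} → Vec Bool k → Bool
allB = foldr′ _∧_ true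

_+ᵛ_ : ∀ {k} → Vec ℕ k → Vec ℕ k → Vec ℕ k
_+ᵛ_ = zipWith _+ℕ_

_∸ᵛ_ : ∀ {k} → Vec ℕ k → Vec ℕ k → Vec ℕ k
_∸ᵛ_ = zipWith _∸_

count> : ∀ {k} → ℕ → Vec ℕ k → ℕ
count> r []       = 0
count> r (s ∷ ss) = b2n (s <ᵇ r) +ℕ count> r ss

Inv : ∀ {k} → Vec ℕ k → ℕ
Inv []       = 0
Inv (r ∷ rs) = count> r rs +ℕ Inv rs

module _ {c ℓ} (R : CommutativeRing c ℓ) where
  open CommutativeRing R

  pow : Carrier → ℕ → Carrier
  pow a zero    = 1#
  pow a (suc e) = a * pow a e

  ind : Bool → Carrier
  ind b = if b then 1# else 0#

  sumL : List Carrier → Carrier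
  sumL []       = 0#
  sumL (a ∷ as) = a + sumL as

  -- a vertex weight: arguments bottom I, left J, top K, right L
  VWeight : ℕ → Set c
  VWeight k = Label k → Label k → Label k → Label k → Carrier

  White : ∀ {k} → (t x : Carrier) → VWeight k
  White t x I J K L =
    ind (eqV (toN I +ᵛ toN J) (toN K +ᵛ toN L)
         ∧ allB (zipWith (λ i j → not (i ∧ j)) I J))
    * (pow x (size L) * pow t (φ (toN L) (toN I +ᵛ toN J)))

  Purple : ∀ {k} → (t x : Carrier) → VWeight k
  Purple t x I J K L =
    ind (eqV (toN I +ᵛ toN J) (toN K +ᵛ toN L)
         ∧ allB (zipWith (λ kc jc → b2n jc ≤ᵇ b2n kc) K J))
    * (pow x (size L) * pow t (φ (toN L) (toN K ∸ᵛ toN J)))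

  -- One row: given the label h on the left edge of the first vertex, the
  -- bottom labels and the top labels of the vertices (left to right),
  -- sum over the labels of the remaining horizontal edges of the product
  -- of the vertex weights; the rightmost edge (right boundary) must be empty.
  rowW : ∀ {k w} → VWeight k → Label k → Vec (Label k) w → Vec (Label k) w → Carrier
  rowW {k} V h []       []       = ind (eqL h (replicate k false))
  rowW {k} V h (b ∷ bs) (u ∷ us) =
    sumL (mapL (λ h′ → V b h u h′ * rowW V h′ bs us) (allLabels k))

  -- Rows listed from bottom to top; bottom and top boundary labels given.
  Z : ∀ {k w} → List (VWeight k) → Vec (Label k) w → Vec (Label k) w → Carrier
  Z {k} {w} []       B T = ind (allB (zipWith eqL B T))
  Z {k} {w} (V ∷ Vs) B T =
    sumL (mapL (λ M → rowW V (replicate k false) B M * Z Vs M T)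
               (allVecs (allLabels k) w))

  -- Bottom boundary on columns -1,0,...,N (N+2 columns): all colours enter
  -- at column -1, nothing elsewhere.
  bottomB : (k N : ℕ) → Vec (Label k) (suc (suc N))
  bottomB k N = replicate k true ∷ replicate (suc N) (replicate k false)

  -- Top boundary: the edge in column c (vector index c+1) carries colour a
  -- iff c = λ_a - 1, i.e. iff the index equals λ_a.
  topB : ∀ {k} (N : ℕ) → Vec ℕ k → Vec (Label k) (suc (suc N))
  topB N lam = Data.Vec.tabulate (λ i → mapV (λ la → la ≡ᵇ toN′ i) lam)
    where
    toN′ : Fin (suc (suc N)) → ℕ
    toN′ = toℕ

  rowsS : ∀ {k n m} → Carrier → Vec Carrier n → Vec Carrier m → List (VWeight k)
  rowsS t xs ys = Data.Vec.toList (mapV (White t) xs)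
                  ++ Data.Vec.toList (mapV (Purple t) ys)

  LS : ∀ {k n m} (N : ℕ) → Vec ℕ k → Vec Carrier n → Vec Carrier m → Carrier → Carrier
  LS {k} N lam xs ys t = Z (rowsS t xs ys) (bottomB k N) (topB N lam)

-- Bubble sort reduces the statement to a single adjacent transposition: if λ_c < λ_{c+1}, then
-- t · 𝓛_λ = 𝓛_{s_c λ}, where s_c λ exchanges λ_c and λ_{c+1} and has exactly one more inversion.
--
-- Exchanging λ_c and λ_{c+1} exchanges the colours c and c+1 on the top boundary T; write u′ for the
-- same colour exchange applied to a row u of vertical edges.  By induction on the number of rows,
-- for every bottom row u,
--   t · Z(u, T) = Z(u, T′)                                 if c and c+1 enter u through one edge,
--                                                          or not exactly once each;
--   t · Z(u, T) + t² · Z(u′, T) = Z(u, T′) + t · Z(u′, T′)  if c enters u strictly left of c+1.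
-- The bottom boundary, where every colour enters in column -1, is of the first kind.  Adding a row
-- sums over the intermediate row in pairs {u, u′}, so it needs the same two identities for a single
-- row of white or purple vertices.  These follow by scanning the row from left to right: the colour
-- exchange changes a vertex weight only through t^φ, and only at the vertex where c and c+1 cross.

module Submission where

open import Level using (_⊔_)
open import Data.Nat using (ℕ; zero; suc; _∸_; _<_; _≤_; s≤s; z≤n; _≡ᵇ_; _<ᵇ_; _≤ᵇ_; _≟_; _<?_)
  renaming (_+_ to _+ℕ_; _*_ to _*ℕ_)
import Data.Nat.Properties as ℕₚ
open import Data.Nat.Tactic.RingSolver using (solve-∀)
open import Data.Bool using (Bool; true; false; _∧_; not; _xor_; T; if_then_else_)
import Data.Bool.Properties as Boolₚ
open import Data.Fin using (Fin; toℕ)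
import Data.Fin as Fin
import Data.Fin.Properties as Finₚ
open import Data.Fin.Permutation using (Permutation′; permutation; _⟨$⟩ʳ_; _⟨$⟩ˡ_; inverseˡ; inverseʳ; flip; _∘ₚ_)
open import Data.Vec using (Vec; []; _∷_; replicate; zipWith; lookup; tabulate; toList) renaming (map to mapV)
import Data.Vec.Properties as Vecₚ
open import Data.List using (List; []; _∷_; _++_; concatMap) renaming (map to mapL)
import Data.List.Properties as Listₚ
open import Data.List.Relation.Unary.All using (All; []; _∷_)
open import Data.List.Relation.Unary.All.Properties using (++⁺)
open import Data.Unit using (⊤; tt)
open import Data.Empty using (⊥-elim)
open import Data.Product using (Σ-syntax; _×_; _,_; proj₁; proj₂)
open import Data.Sum using (_⊎_; inj₁; inj₂)
open import Relation.Nullary using (¬_; Dec; yes; no; does)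
open import Relation.Binary.PropositionalEquality as P using (_≡_; _≢_; cong; cong₂)
open import Algebra.Bundles using (CommutativeRing; CommutativeMonoid)
open import Algebra.Properties.CommutativeSemigroup ℕₚ.+-commutativeSemigroup
  using () renaming (x∙yz≈y∙xz to +-exchange)
open import Algebra.Properties.CommutativeSemigroup (CommutativeMonoid.commutativeSemigroup Boolₚ.∧-commutativeMonoid)
  using () renaming (x∙yz≈y∙xz to ∧-exchange)

open import Defs

-- Adjacent transpositions and entries of vectors

swapAt : ∀ {a} {A : Set a} {k} → ℕ → Vec A k → Vec A k
swapAt zero    []          = []
swapAt zero    (x ∷ [])    = x ∷ []
swapAt zero    (x ∷ y ∷ v) = y ∷ x ∷ v
swapAt (suc c) []          = []
swapAt (suc c) (x ∷ v)     = x ∷ swapAt c v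

swapAt-involutive : ∀ {a} {A : Set a} {k} c (v : Vec A k) → swapAt c (swapAt c v) ≡ v
swapAt-involutive zero    []          = P.refl
swapAt-involutive zero    (x ∷ [])    = P.refl
swapAt-involutive zero    (x ∷ y ∷ v) = P.refl
swapAt-involutive (suc c) []          = P.refl
swapAt-involutive (suc c) (x ∷ v)     = cong (x ∷_) (swapAt-involutive c v)

map-swapAt : ∀ {a b} {A : Set a} {B : Set b} {k} (f : A → B) c (v : Vec A k) →
             mapV f (swapAt c v) ≡ swapAt c (mapV f v)
map-swapAt f zero    []          = P.refl
map-swapAt f zero    (x ∷ [])    = P.refl
map-swapAt f zero    (x ∷ y ∷ v) = P.refl
map-swapAt f (suc c) []          = P.refl
map-swapAt f (suc c) (x ∷ v)     = cong (f x ∷_) (map-swapAt f c v)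

zipWith-swapAt : ∀ {a b d} {A : Set a} {B : Set b} {C : Set d} {k} (f : A → B → C) c
                 (u : Vec A k) (v : Vec B k) → zipWith f (swapAt c u) (swapAt c v) ≡ swapAt c (zipWith f u v)
zipWith-swapAt f zero    []          []          = P.refl
zipWith-swapAt f zero    (x ∷ [])    (y ∷ [])    = P.refl
zipWith-swapAt f zero    (x ∷ x′ ∷ u) (y ∷ y′ ∷ v) = P.refl
zipWith-swapAt f (suc c) []          []          = P.refl
zipWith-swapAt f (suc c) (x ∷ u)     (y ∷ v)     = cong (f x y ∷_) (zipWith-swapAt f c u v)

swapAt-replicate : ∀ {a} {A : Set a} k c (x : A) → swapAt c (replicate k x) ≡ replicate k x
swapAt-replicate zero          zero    x = P.refl
swapAt-replicate (suc zero)    zero    x = P.refl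
swapAt-replicate (suc (suc k)) zero    x = P.refl
swapAt-replicate zero          (suc c) x = P.refl
swapAt-replicate (suc k)       (suc c) x = cong (x ∷_) (swapAt-replicate k c x)

sumV-swapAt : ∀ {k} c (v : Vec ℕ k) → sumV (swapAt c v) ≡ sumV v
sumV-swapAt zero    []          = P.refl
sumV-swapAt zero    (x ∷ [])    = P.refl
sumV-swapAt zero    (x ∷ y ∷ v) = +-exchange y x (sumV v)
sumV-swapAt (suc c) []          = P.refl
sumV-swapAt (suc c) (x ∷ v)     = cong (x +ℕ_) (sumV-swapAt c v)

allB-swapAt : ∀ {k} c (v : Vec Bool k) → allB (swapAt c v) ≡ allB v
allB-swapAt zero    []          = P.refl
allB-swapAt zero    (x ∷ [])    = P.refl
allB-swapAt zero    (x ∷ y ∷ v) = ∧-exchange y x (allB v)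
allB-swapAt (suc c) []          = P.refl
allB-swapAt (suc c) (x ∷ v)     = cong (x ∧_) (allB-swapAt c v)

eqV-swapAt : ∀ {k} c (u v : Vec ℕ k) → eqV (swapAt c u) (swapAt c v) ≡ eqV u v
eqV-swapAt zero    []           []           = P.refl
eqV-swapAt zero    (x ∷ [])     (y ∷ [])     = P.refl
eqV-swapAt zero    (x ∷ x′ ∷ u) (y ∷ y′ ∷ v) = ∧-exchange (x′ ≡ᵇ y′) (x ≡ᵇ y) (eqV u v)
eqV-swapAt (suc c) []           []           = P.refl
eqV-swapAt (suc c) (x ∷ u)      (y ∷ v)      = cong ((x ≡ᵇ y) ∧_) (eqV-swapAt c u v)

count>-swapAt : ∀ {k} r c (v : Vec ℕ k) → count> r (swapAt c v) ≡ count> r v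
count>-swapAt r zero    []          = P.refl
count>-swapAt r zero    (x ∷ [])    = P.refl
count>-swapAt r zero    (x ∷ y ∷ v) = +-exchange (b2n (y <ᵇ r)) (b2n (x <ᵇ r)) (count> r v)
count>-swapAt r (suc c) []          = P.refl
count>-swapAt r (suc c) (x ∷ v)     = cong (b2n (x <ᵇ r) +ℕ_) (count>-swapAt r c v)

entry : ∀ {k} → ℕ → Vec ℕ k → ℕ
entry _       []      = 0
entry zero    (x ∷ v) = x
entry (suc c) (x ∷ v) = entry c v

true≢false : true ≢ false
true≢false ()

bit : ∀ {k} → ℕ → Vec Bool k → Bool
bit _       []      = false
bit zero    (x ∷ v) = x
bit (suc c) (x ∷ v) = bit c v

entry-toN : ∀ {k} c (v : Vec Bool k) → entry c (toN v) ≡ b2n (bit c v)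
entry-toN _       []      = P.refl
entry-toN zero    (x ∷ v) = P.refl
entry-toN (suc c) (x ∷ v) = entry-toN c v

entry-toN-of : ∀ {k} c (v : Vec Bool k) {β} → bit c v ≡ β → entry c (toN v) ≡ b2n β
entry-toN-of c v e = P.trans (entry-toN c v) (cong b2n e)

entry-toN-absent-* : ∀ {k} c (v : Vec Bool k) {m} → bit c v ≡ false → entry c (toN v) *ℕ m ≡ 0
entry-toN-absent-* c v e = cong (_*ℕ _) (entry-toN-of c v e)

*-≡0ʳ : ∀ n {m} → m ≡ 0 → n *ℕ m ≡ 0
*-≡0ʳ n P.refl = ℕₚ.*-zeroʳ n

entry-+ᵛ : ∀ {k} c (u v : Vec ℕ k) → entry c (u +ᵛ v) ≡ entry c u +ℕ entry c v
entry-+ᵛ _       []      []      = P.refl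
entry-+ᵛ zero    (x ∷ u) (y ∷ v) = P.refl
entry-+ᵛ (suc c) (x ∷ u) (y ∷ v) = entry-+ᵛ c u v

entry-∸ᵛ : ∀ {k} c (u v : Vec ℕ k) → entry c (u ∸ᵛ v) ≡ entry c u ∸ entry c v
entry-∸ᵛ _       []      []      = P.refl
entry-∸ᵛ zero    (x ∷ u) (y ∷ v) = P.refl
entry-∸ᵛ (suc c) (x ∷ u) (y ∷ v) = entry-∸ᵛ c u v

bit-zipWith : ∀ {k} (f : Bool → Bool → Bool) → f false false ≡ false → ∀ c (u v : Vec Bool k) →
              bit c (zipWith f u v) ≡ f (bit c u) (bit c v)
bit-zipWith f f00 _       []      []      = P.sym f00
bit-zipWith f f00 zero    (x ∷ u) (y ∷ v) = P.refl
bit-zipWith f f00 (suc c) (x ∷ u) (y ∷ v) = bit-zipWith f f00 c u v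

bit-replicate : ∀ k c (x : Bool) → c < k → bit c (replicate k x) ≡ x
bit-replicate (suc k) zero    x _       = P.refl
bit-replicate (suc k) (suc c) x (s≤s r) = bit-replicate k c x r

bit-replicate-false : ∀ k c → bit c (replicate k false) ≡ false
bit-replicate-false zero    c       = P.refl
bit-replicate-false (suc k) zero    = P.refl
bit-replicate-false (suc k) (suc c) = bit-replicate-false k c

bit-map : ∀ {k} (f : ℕ → Bool) c (v : Vec ℕ k) → c < k → bit c (mapV f v) ≡ f (entry c v)
bit-map f zero    (x ∷ v) _       = P.refl
bit-map f (suc c) (x ∷ v) (s≤s r) = bit-map f c v r

bit-swapAt-here : ∀ {k} c (v : Vec Bool k) → suc c < k → bit c (swapAt c v) ≡ bit (suc c) v
bit-swapAt-here zero    (x ∷ [])    (s≤s ())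
bit-swapAt-here zero    (x ∷ y ∷ v) _       = P.refl
bit-swapAt-here (suc c) (x ∷ v)     (s≤s r) = bit-swapAt-here c v r

bit-swapAt-next : ∀ {k} c (v : Vec Bool k) → suc c < k → bit (suc c) (swapAt c v) ≡ bit c v
bit-swapAt-next zero    (x ∷ [])    (s≤s ())
bit-swapAt-next zero    (x ∷ y ∷ v) _       = P.refl
bit-swapAt-next (suc c) (x ∷ v)     (s≤s r) = bit-swapAt-next c v r

swapAt-fixes-bits : ∀ {k} c (v : Vec Bool k) → bit c v ≡ bit (suc c) v → swapAt c v ≡ v
swapAt-fixes-bits zero    []          e = P.refl
swapAt-fixes-bits zero    (x ∷ [])    e = P.refl
swapAt-fixes-bits zero    (x ∷ y ∷ v) e = cong₂ (λ x′ y′ → x′ ∷ y′ ∷ v) (P.sym e) e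
swapAt-fixes-bits (suc c) []          e = P.refl
swapAt-fixes-bits (suc c) (x ∷ v)     e = cong (x ∷_) (swapAt-fixes-bits c v e)

swapAt-fixes-entries : ∀ {k} c (v : Vec ℕ k) → entry c v ≡ entry (suc c) v → swapAt c v ≡ v
swapAt-fixes-entries zero    []          e = P.refl
swapAt-fixes-entries zero    (x ∷ [])    e = P.refl
swapAt-fixes-entries zero    (x ∷ y ∷ v) e = cong₂ (λ x′ y′ → x′ ∷ y′ ∷ v) (P.sym e) e
swapAt-fixes-entries (suc c) []          e = P.refl
swapAt-fixes-entries (suc c) (x ∷ v)     e = cong (x ∷_) (swapAt-fixes-entries c v e)

φ-swapAt : ∀ {k} c (u v : Vec ℕ k) →
           φ (swapAt c u) (swapAt c v) +ℕ entry c u *ℕ entry (suc c) v ≡ φ u v +ℕ entry (suc c) u *ℕ entry c v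
φ-swapAt zero    []            []            = P.refl
φ-swapAt zero    (x ∷ [])      (y ∷ [])      = cong (φ (x ∷ []) (y ∷ []) +ℕ_) (ℕₚ.*-zeroʳ x)
φ-swapAt zero    (x₀ ∷ x₁ ∷ u) (y₀ ∷ y₁ ∷ v) = exchange x₀ x₁ y₀ y₁ (sumV v) (φ u v)
  where
  exchange : ∀ x₀ x₁ y₀ y₁ s f → x₁ *ℕ (y₀ +ℕ s) +ℕ (x₀ *ℕ s +ℕ f) +ℕ x₀ *ℕ y₁
                                ≡ x₀ *ℕ (y₁ +ℕ s) +ℕ (x₁ *ℕ s +ℕ f) +ℕ x₁ *ℕ y₀
  exchange = solve-∀
φ-swapAt (suc c) []            []            = P.refl
φ-swapAt (suc c) (x ∷ u)       (y ∷ v)       = begin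
  x *ℕ sumV (swapAt c v) +ℕ φ (swapAt c u) (swapAt c v) +ℕ entry c u *ℕ entry (suc c) v
    ≡⟨ ℕₚ.+-assoc (x *ℕ sumV (swapAt c v)) _ _ ⟩
  x *ℕ sumV (swapAt c v) +ℕ (φ (swapAt c u) (swapAt c v) +ℕ entry c u *ℕ entry (suc c) v)
    ≡⟨ cong₂ _+ℕ_ (cong (x *ℕ_) (sumV-swapAt c v)) (φ-swapAt c u v) ⟩
  x *ℕ sumV v +ℕ (φ u v +ℕ entry (suc c) u *ℕ entry c v)
    ≡⟨ ℕₚ.+-assoc (x *ℕ sumV v) _ _ ⟨
  x *ℕ sumV v +ℕ φ u v +ℕ entry (suc c) u *ℕ entry c v ∎
  where open P.≡-Reasoning

-- Labels of a vertex and conservation of colours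

outflow : ∀ {k} → Label k → Label k → Label k → Label k
outflow I J K = zipWith _xor_ (zipWith _xor_ I J) K

bit-outflow : ∀ {k} j (I J K : Label k) → bit j (outflow I J K) ≡ (bit j I xor bit j J) xor bit j K
bit-outflow j I J K = P.trans (bit-zipWith _xor_ P.refl j (zipWith _xor_ I J) K)
  (cong (_xor bit j K) (bit-zipWith _xor_ P.refl j I J))

bit-outflow-of : ∀ {k} j (I J K : Label k) {β₁ β₂ β₃} → bit j I ≡ β₁ → bit j J ≡ β₂ → bit j K ≡ β₃ →
                 bit j (outflow I J K) ≡ (β₁ xor β₂) xor β₃
bit-outflow-of j I J K P.refl P.refl P.refl = bit-outflow j I J K

outflow-swapAt : ∀ {k} c (I J K : Label k) →
                 outflow (swapAt c I) (swapAt c J) (swapAt c K) ≡ swapAt c (outflow I J K)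
outflow-swapAt c I J K = P.trans (cong (λ z → zipWith _xor_ z (swapAt c K)) (zipWith-swapAt _xor_ c I J))
  (zipWith-swapAt _xor_ c (zipWith _xor_ I J) K)

outflow-swapAt-inflow : ∀ {k} c (I J K : Label k) → (bit c I xor bit c J) ≡ (bit (suc c) I xor bit (suc c) J) →
                        outflow (swapAt c I) (swapAt c J) K ≡ outflow I J K
outflow-swapAt-inflow c I J K e = cong (λ z → zipWith _xor_ z K)
  (P.trans (zipWith-swapAt _xor_ c I J) (swapAt-fixes-bits c (zipWith _xor_ I J)
     (P.trans (bit-zipWith _xor_ P.refl c I J) (P.trans e (P.sym (bit-zipWith _xor_ P.refl (suc c) I J))))))

eqV⇒entry≡ : ∀ {k} j (u v : Vec ℕ k) → eqV u v ≡ true → entry j u ≡ entry j v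
eqV⇒entry≡ j       []      []      e = P.refl
eqV⇒entry≡ zero    (x ∷ u) (y ∷ v) e = ℕₚ.≡ᵇ⇒≡ x y (P.subst T (P.sym (Boolₚ.∧-conicalˡ _ _ e)) tt)
eqV⇒entry≡ (suc j) (x ∷ u) (y ∷ v) e = eqV⇒entry≡ j u v (Boolₚ.∧-conicalʳ _ _ e)

balanced-bit⇒xor : ∀ i j k l → ((b2n i +ℕ b2n j) ≡ᵇ (b2n k +ℕ b2n l)) ≡ true → l ≡ (i xor j) xor k
balanced-bit⇒xor false false false false e = P.refl
balanced-bit⇒xor false true  false true  e = P.refl
balanced-bit⇒xor false true  true  false e = P.refl
balanced-bit⇒xor true  false false true  e = P.refl
balanced-bit⇒xor true  false true  false e = P.refl
balanced-bit⇒xor true  true  true  true  e = P.refl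
balanced-bit⇒xor false false false true  ()
balanced-bit⇒xor false false true  false ()
balanced-bit⇒xor false false true  true  ()
balanced-bit⇒xor false true  false false ()
balanced-bit⇒xor false true  true  true  ()
balanced-bit⇒xor true  false false false ()
balanced-bit⇒xor true  false true  true  ()
balanced-bit⇒xor true  true  false false ()
balanced-bit⇒xor true  true  false true  ()
balanced-bit⇒xor true  true  true  false ()

balanced⇒outflow : ∀ {k} (I J K L : Label k) → eqV (toN I +ᵛ toN J) (toN K +ᵛ toN L) ≡ true → L ≡ outflow I J K
balanced⇒outflow []      []      []      []      e = P.refl
balanced⇒outflow (i ∷ I) (j ∷ J) (k ∷ K) (l ∷ L) e =
  cong₂ _∷_ (balanced-bit⇒xor i j k l (Boolₚ.∧-conicalˡ _ _ e)) (balanced⇒outflow I J K L (Boolₚ.∧-conicalʳ _ _ e))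

allB-zipWith-false : ∀ {k} (f : Bool → Bool → Bool) j (I J : Label k) → f (bit j I) (bit j J) ≡ false →
                     bit j J ≡ true → allB (zipWith f I J) ≡ false
allB-zipWith-false f j       []      []      e ()
allB-zipWith-false f zero    (x ∷ I) (y ∷ J) e _ rewrite e = P.refl
allB-zipWith-false f (suc j) (x ∷ I) (y ∷ J) e h rewrite allB-zipWith-false f j I J e h = Boolₚ.∧-zeroʳ (f x y)

balanced⇒bit-balanced : ∀ {k} j (I J K L : Label k) → eqV (toN I +ᵛ toN J) (toN K +ᵛ toN L) ≡ true →
                        b2n (bit j I) +ℕ b2n (bit j J) ≡ b2n (bit j K) +ℕ b2n (bit j L)
balanced⇒bit-balanced j I J K L balanced = begin
  b2n (bit j I) +ℕ b2n (bit j J) ≡⟨ entry-sum I J ⟨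
  entry j (toN I +ᵛ toN J)       ≡⟨ eqV⇒entry≡ j (toN I +ᵛ toN J) (toN K +ᵛ toN L) balanced ⟩
  entry j (toN K +ᵛ toN L)       ≡⟨ entry-sum K L ⟩
  b2n (bit j K) +ℕ b2n (bit j L) ∎
  where
  open P.≡-Reasoning
  entry-sum : ∀ A B → entry j (toN A +ᵛ toN B) ≡ b2n (bit j A) +ℕ b2n (bit j B)
  entry-sum A B = P.trans (entry-+ᵛ j (toN A) (toN B)) (cong₂ _+ℕ_ (entry-toN j A) (entry-toN j B))

size-swapAt : ∀ {k} c (L : Label k) → size (swapAt c L) ≡ size L
size-swapAt c L = P.trans (cong sumV (map-swapAt b2n c L)) (sumV-swapAt c (toN L))

balance-swapAt : ∀ {k} c (I J K L : Label k) →
                 eqV (toN (swapAt c I) +ᵛ toN (swapAt c J)) (toN (swapAt c K) +ᵛ toN (swapAt c L))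
                 ≡ eqV (toN I +ᵛ toN J) (toN K +ᵛ toN L)
balance-swapAt c I J K L = P.trans (cong₂ eqV (sum-swapAt I J) (sum-swapAt K L)) (eqV-swapAt c _ _)
  where
  sum-swapAt : ∀ A B → toN (swapAt c A) +ᵛ toN (swapAt c B) ≡ swapAt c (toN A +ᵛ toN B)
  sum-swapAt A B = P.trans (cong₂ _+ᵛ_ (map-swapAt b2n c A) (map-swapAt b2n c B)) (zipWith-swapAt _+ℕ_ c (toN A) (toN B))

eqL-refl : ∀ {k} (v : Label k) → eqL v v ≡ true
eqL-refl []         = P.refl
eqL-refl (true ∷ v)  = eqL-refl v
eqL-refl (false ∷ v) = eqL-refl v

eqL⇒≡ : ∀ {k} (u v : Label k) → eqL u v ≡ true → u ≡ v
eqL⇒≡ []          []          e = P.refl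
eqL⇒≡ (true ∷ u)  (true ∷ v)  e = cong (true ∷_) (eqL⇒≡ u v e)
eqL⇒≡ (false ∷ u) (false ∷ v) e = cong (false ∷_) (eqL⇒≡ u v e)

eqL-empty-false : ∀ {k} j (h : Label k) → bit j h ≡ true → eqL h (replicate k false) ≡ false
eqL-empty-false {k} j h e with eqL h (replicate k false) in eq
... | false = P.refl
... | true with P.trans (P.sym e) (P.trans (cong (bit j) (eqL⇒≡ h _ eq)) (bit-replicate-false k j))
...   | ()

eqL-empty-swapAt : ∀ {k} c (h : Label k) → eqL (swapAt c h) (replicate k false) ≡ eqL h (replicate k false)
eqL-empty-swapAt {k} c h =
  P.trans (cong₂ eqV (map-swapAt b2n c h)
            (P.trans (cong toN (P.sym (swapAt-replicate k c false))) (map-swapAt b2n c (replicate k false))))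
          (eqV-swapAt c (toN h) (toN (replicate k false)))

allEqL-refl : ∀ {k w} (u : Vec (Label k) w) → allB (zipWith eqL u u) ≡ true
allEqL-refl []      = P.refl
allEqL-refl (x ∷ u) rewrite eqL-refl x = allEqL-refl u

allEqL⇒≡ : ∀ {k w} (u v : Vec (Label k) w) → allB (zipWith eqL u v) ≡ true → u ≡ v
allEqL⇒≡ []      []      e = P.refl
allEqL⇒≡ (x ∷ u) (y ∷ v) e =
  cong₂ _∷_ (eqL⇒≡ x y (Boolₚ.∧-conicalˡ _ _ e)) (allEqL⇒≡ u v (Boolₚ.∧-conicalʳ _ _ e))

-- Rows of edge labels

Without : ∀ {k w} → ℕ → Vec (Label k) w → Set
Without j []       = ⊤
Without j (v ∷ vs) = bit j v ≡ false × Without j vs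

count : ∀ {k w} → ℕ → Vec (Label k) w → ℕ
count j []       = 0
count j (v ∷ vs) = b2n (bit j v) +ℕ count j vs

+-balance-trans : ∀ {a b c d e f} → a +ℕ b ≡ c +ℕ d → d +ℕ e ≡ f → b +ℕ (a +ℕ e) ≡ c +ℕ f
+-balance-trans {a} {b} {c} {d} {e} {f} ab≡cd de≡f = begin
  b +ℕ (a +ℕ e) ≡⟨ +-exchange b a e ⟩
  a +ℕ (b +ℕ e) ≡⟨ ℕₚ.+-assoc a b e ⟨
  a +ℕ b +ℕ e   ≡⟨ cong (_+ℕ e) ab≡cd ⟩
  c +ℕ d +ℕ e   ≡⟨ ℕₚ.+-assoc c d e ⟩
  c +ℕ (d +ℕ e) ≡⟨ cong (c +ℕ_) de≡f ⟩
  c +ℕ f        ∎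
  where open P.≡-Reasoning

swapColours : ∀ {k w} → ℕ → Vec (Label k) w → Vec (Label k) w
swapColours c = mapV (swapAt c)

swapColours-involutive : ∀ {k w} c (vs : Vec (Label k) w) → swapColours c (swapColours c vs) ≡ vs
swapColours-involutive c []       = P.refl
swapColours-involutive c (v ∷ vs) = cong₂ _∷_ (swapAt-involutive c v) (swapColours-involutive c vs)

swapColours-injective : ∀ {k w} c (us vs : Vec (Label k) w) → swapColours c us ≡ swapColours c vs → us ≡ vs
swapColours-injective c us vs e =
  P.trans (P.sym (swapColours-involutive c us)) (P.trans (cong (swapColours c) e) (swapColours-involutive c vs))

module TwoColours {k : ℕ} (c : ℕ) (c+1<k : suc c < k) where

  swapped-here : ∀ {β} (v : Label k) → bit (suc c) v ≡ β → bit c (swapAt c v) ≡ β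
  swapped-here v = P.trans (bit-swapAt-here c v c+1<k)

  swapped-next : ∀ {β} (v : Label k) → bit c v ≡ β → bit (suc c) (swapAt c v) ≡ β
  swapped-next v = P.trans (bit-swapAt-next c v c+1<k)

  fixed-by-swap : ∀ {β} (v : Label k) → bit c v ≡ β → bit (suc c) v ≡ β → swapAt c v ≡ v
  fixed-by-swap v here next = swapAt-fixes-bits c v (P.trans here (P.sym next))

  Without-swapColours : ∀ {w} (vs : Vec (Label k) w) → Without c vs → Without (suc c) (swapColours c vs)
  Without-swapColours []       tt       = tt
  Without-swapColours (v ∷ vs) (e , ws) = swapped-next v e , Without-swapColours vs ws

  count-swapColours-here : ∀ {w} (vs : Vec (Label k) w) → count c (swapColours c vs) ≡ count (suc c) vs
  count-swapColours-here []       = P.refl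
  count-swapColours-here (v ∷ vs) = cong₂ _+ℕ_ (cong b2n (bit-swapAt-here c v c+1<k)) (count-swapColours-here vs)

  count-swapColours-next : ∀ {w} (vs : Vec (Label k) w) → count (suc c) (swapColours c vs) ≡ count c vs
  count-swapColours-next []       = P.refl
  count-swapColours-next (v ∷ vs) = cong₂ _+ℕ_ (cong b2n (bit-swapAt-next c v c+1<k)) (count-swapColours-next vs)

  data Clear : ∀ {w} → Vec (Label k) w → Set where
    clear[] : Clear []
    clear∷  : ∀ {w v} {vs : Vec (Label k) w} → bit c v ≡ false → bit (suc c) v ≡ false → Clear vs → Clear (v ∷ vs)

  data NextOnly : ∀ {w} → Vec (Label k) w → Set where
    next-skip : ∀ {w v} {vs : Vec (Label k) w} → bit c v ≡ false → bit (suc c) v ≡ false → NextOnly vs → NextOnly (v ∷ vs)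
    next-here : ∀ {w v} {vs : Vec (Label k) w} → bit c v ≡ false → bit (suc c) v ≡ true → Clear vs → NextOnly (v ∷ vs)

  data Ordered : ∀ {w} → Vec (Label k) w → Set where
    ord-skip : ∀ {w v} {vs : Vec (Label k) w} → bit c v ≡ false → bit (suc c) v ≡ false → Ordered vs → Ordered (v ∷ vs)
    ord-here : ∀ {w v} {vs : Vec (Label k) w} → bit c v ≡ true → bit (suc c) v ≡ false → NextOnly vs → Ordered (v ∷ vs)

  data Tied : ∀ {w} → Vec (Label k) w → Set where
    tied-skip : ∀ {w v} {vs : Vec (Label k) w} → bit c v ≡ false → bit (suc c) v ≡ false → Tied vs → Tied (v ∷ vs)
    tied-here : ∀ {w v} {vs : Vec (Label k) w} → bit c v ≡ true → bit (suc c) v ≡ true → Clear vs → Tied (v ∷ vs)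

  OnceEach : ∀ {w} → Vec (Label k) w → Set
  OnceEach vs = count c vs ≡ 1 × count (suc c) vs ≡ 1

  Clear-empty : ∀ w → Clear (replicate w (replicate k false))
  Clear-empty zero    = clear[]
  Clear-empty (suc w) = clear∷ (bit-replicate-false k c) (bit-replicate-false k (suc c)) (Clear-empty w)

  Clear⇒Without-c : ∀ {w} {vs : Vec (Label k) w} → Clear vs → Without c vs
  Clear⇒Without-c clear[]        = tt
  Clear⇒Without-c (clear∷ e _ z) = e , Clear⇒Without-c z

  NextOnly⇒Without-c : ∀ {w} {vs : Vec (Label k) w} → NextOnly vs → Without c vs
  NextOnly⇒Without-c (next-skip e _ o) = e , NextOnly⇒Without-c o
  NextOnly⇒Without-c (next-here e _ z) = e , Clear⇒Without-c z

  Clear-fixed : ∀ {w} {vs : Vec (Label k) w} → Clear vs → swapColours c vs ≡ vs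
  Clear-fixed clear[]                        = P.refl
  Clear-fixed {vs = v ∷ _} (clear∷ here next z) = cong₂ _∷_ (fixed-by-swap v here next) (Clear-fixed z)

  Tied-fixed : ∀ {w} {vs : Vec (Label k) w} → Tied vs → swapColours c vs ≡ vs
  Tied-fixed {vs = v ∷ _} (tied-skip here next t) = cong₂ _∷_ (fixed-by-swap v here next) (Tied-fixed t)
  Tied-fixed {vs = v ∷ _} (tied-here here next z) = cong₂ _∷_ (fixed-by-swap v here next) (Clear-fixed z)

  Clear-count : ∀ {w} {vs : Vec (Label k) w} → Clear vs → count c vs ≡ 0 × count (suc c) vs ≡ 0
  Clear-count clear[] = P.refl , P.refl
  Clear-count (clear∷ here next z) with Clear-count z
  ... | e₁ , e₂ rewrite here | next = e₁ , e₂

  NextOnly-count : ∀ {w} {vs : Vec (Label k) w} → NextOnly vs → count c vs ≡ 0 × count (suc c) vs ≡ 1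
  NextOnly-count (next-skip here next o) with NextOnly-count o
  ... | e₁ , e₂ rewrite here | next = e₁ , e₂
  NextOnly-count (next-here here next z) with Clear-count z
  ... | e₁ , e₂ rewrite here | next = e₁ , cong suc e₂

  Ordered-count : ∀ {w} {vs : Vec (Label k) w} → Ordered vs → OnceEach vs
  Ordered-count (ord-skip here next o) with Ordered-count o
  ... | e₁ , e₂ rewrite here | next = e₁ , e₂
  Ordered-count (ord-here here next o) with NextOnly-count o
  ... | e₁ , e₂ rewrite here | next = cong suc e₁ , e₂

  Ordered-swapped-count : ∀ {w} {vs : Vec (Label k) w} → Ordered vs → OnceEach (swapColours c vs)
  Ordered-swapped-count {vs = vs} o =
    P.trans (count-swapColours-here vs) (proj₂ (Ordered-count o)) ,
    P.trans (count-swapColours-next vs) (proj₁ (Ordered-count o))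

  Clear-from-count : ∀ {w} (vs : Vec (Label k) w) → count c vs ≡ 0 → count (suc c) vs ≡ 0 → Clear vs
  Clear-from-count []       _  _  = clear[]
  Clear-from-count (v ∷ vs) e₁ e₂ with bit c v in here | bit (suc c) v in next
  ... | false | false = clear∷ here next (Clear-from-count vs e₁ e₂)
  Clear-from-count (v ∷ vs) () e₂ | true  | _
  Clear-from-count (v ∷ vs) e₁ () | false | true

  NextOnly-from-count : ∀ {w} (vs : Vec (Label k) w) → count c vs ≡ 0 → count (suc c) vs ≡ 1 → NextOnly vs
  NextOnly-from-count []       _  ()
  NextOnly-from-count (v ∷ vs) e₁ e₂ with bit c v in here | bit (suc c) v in next
  ... | false | false = next-skip here next (NextOnly-from-count vs e₁ e₂)
  ... | false | true  = next-here here next (Clear-from-count vs e₁ (ℕₚ.suc-injective e₂))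
  NextOnly-from-count (v ∷ vs) () e₂ | true | _

  OnceEach-cases : ∀ {w} (vs : Vec (Label k) w) → OnceEach vs → Ordered vs ⊎ Ordered (swapColours c vs) ⊎ Tied vs
  OnceEach-cases []       (() , _)
  OnceEach-cases (v ∷ vs) (e₁ , e₂) with bit c v in here | bit (suc c) v in next
  ... | false | false with OnceEach-cases vs (e₁ , e₂)
  ...   | inj₁ o        = inj₁ (ord-skip here next o)
  ...   | inj₂ (inj₁ o) = inj₂ (inj₁ (ord-skip (swapped-here v next) (swapped-next v here) o))
  ...   | inj₂ (inj₂ t) = inj₂ (inj₂ (tied-skip here next t))
  OnceEach-cases (v ∷ vs) (e₁ , e₂) | true | false =
    inj₁ (ord-here here next (NextOnly-from-count vs (ℕₚ.suc-injective e₁) e₂))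
  OnceEach-cases (v ∷ vs) (e₁ , e₂) | false | true = inj₂ (inj₁ (ord-here (swapped-here v next) (swapped-next v here)
    (NextOnly-from-count (swapColours c vs) (P.trans (count-swapColours-here vs) (ℕₚ.suc-injective e₂))
                                            (P.trans (count-swapColours-next vs) e₁))))
  OnceEach-cases (v ∷ vs) (e₁ , e₂) | true | true =
    inj₂ (inj₂ (tied-here here next (Clear-from-count vs (ℕₚ.suc-injective e₁) (ℕₚ.suc-injective e₂))))

  Ordered⇒¬Ordered-swapped : ∀ {w} {vs : Vec (Label k) w} → Ordered vs → ¬ Ordered (swapColours c vs)
  Ordered⇒¬Ordered-swapped (ord-skip _ _ o) (ord-skip _ _ o′) = Ordered⇒¬Ordered-swapped o o′
  Ordered⇒¬Ordered-swapped {vs = v ∷ _} (ord-skip _ next _) (ord-here here′ _ _) =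
    true≢false (P.trans (P.sym here′) (swapped-here v next))
  Ordered⇒¬Ordered-swapped {vs = v ∷ _} (ord-here here _ _) (ord-skip _ next′ _) =
    true≢false (P.trans (P.sym (swapped-next v here)) next′)
  Ordered⇒¬Ordered-swapped {vs = v ∷ _} (ord-here _ next _) (ord-here here′ _ _) =
    true≢false (P.trans (P.sym here′) (swapped-here v next))

  Ordered⇒¬Tied : ∀ {w} {vs : Vec (Label k) w} → Ordered vs → ¬ Tied vs
  Ordered⇒¬Tied (ord-skip _    _    o) (tied-skip _     _     t) = Ordered⇒¬Tied o t
  Ordered⇒¬Tied (ord-skip here _    _) (tied-here here′ _     _) = true≢false (P.trans (P.sym here′) here)
  Ordered⇒¬Tied (ord-here here _    _) (tied-skip here′ _     _) = true≢false (P.trans (P.sym here) here′)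
  Ordered⇒¬Tied (ord-here _    next _) (tied-here _     next′ _) = true≢false (P.trans (P.sym next′) next)

  Clear? : ∀ {w} (vs : Vec (Label k) w) → Dec (Clear vs)
  Clear? []       = yes clear[]
  Clear? (v ∷ vs) with bit c v in here | bit (suc c) v in next | Clear? vs
  ... | false | false | yes z = yes (clear∷ here next z)
  ... | false | false | no ¬z = no λ { (clear∷ _ _ z) → ¬z z }
  ... | true  | _     | _     = no λ { (clear∷ e _ _) → true≢false (P.trans (P.sym here) e) }
  ... | false | true  | _     = no λ { (clear∷ _ e _) → true≢false (P.trans (P.sym next) e) }

  NextOnly? : ∀ {w} (vs : Vec (Label k) w) → Dec (NextOnly vs)
  NextOnly? []       = no λ ()
  NextOnly? (v ∷ vs) with bit c v in here | bit (suc c) v in next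
  ... | true  | _ = no λ { (next-skip e _ _) → true≢false (P.trans (P.sym here) e)
                         ; (next-here e _ _) → true≢false (P.trans (P.sym here) e) }
  ... | false | false with NextOnly? vs
  ...   | yes o = yes (next-skip here next o)
  ...   | no ¬o = no λ { (next-skip _ _ o) → ¬o o ; (next-here _ e _) → true≢false (P.trans (P.sym e) next) }
  NextOnly? (v ∷ vs) | false | true with Clear? vs
  ...   | yes z = yes (next-here here next z)
  ...   | no ¬z = no λ { (next-skip _ e _) → true≢false (P.trans (P.sym next) e) ; (next-here _ _ z) → ¬z z }

  Ordered? : ∀ {w} (vs : Vec (Label k) w) → Dec (Ordered vs)
  Ordered? []       = no λ ()
  Ordered? (v ∷ vs) with bit c v in here | bit (suc c) v in next
  ... | false | false with Ordered? vs
  ...   | yes o = yes (ord-skip here next o)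
  ...   | no ¬o = no λ { (ord-skip _ _ o) → ¬o o ; (ord-here e _ _) → true≢false (P.trans (P.sym e) here) }
  Ordered? (v ∷ vs) | false | true =
    no λ { (ord-skip _ e _) → true≢false (P.trans (P.sym next) e) ; (ord-here e _ _) → true≢false (P.trans (P.sym e) here) }
  Ordered? (v ∷ vs) | true | true =
    no λ { (ord-skip e _ _) → true≢false (P.trans (P.sym here) e) ; (ord-here _ e _) → true≢false (P.trans (P.sym next) e) }
  Ordered? (v ∷ vs) | true | false with NextOnly? vs
  ...   | yes o = yes (ord-here here next o)
  ...   | no ¬o = no λ { (ord-skip e _ _) → true≢false (P.trans (P.sym here) e) ; (ord-here _ _ o) → ¬o o }

  unordered⇒Tied⊎¬OnceEach : ∀ {w} (vs : Vec (Label k) w) → ¬ Ordered vs → ¬ Ordered (swapColours c vs) →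
                             Tied vs ⊎ ¬ OnceEach vs
  unordered⇒Tied⊎¬OnceEach vs ¬o ¬o′ with count c vs ≟ 1 | count (suc c) vs ≟ 1
  ... | no ¬e   | _      = inj₂ (λ e → ¬e (proj₁ e))
  ... | yes _   | no ¬e  = inj₂ (λ e → ¬e (proj₂ e))
  ... | yes e₁  | yes e₂ with OnceEach-cases vs (e₁ , e₂)
  ...   | inj₁ o        = ⊥-elim (¬o o)
  ...   | inj₂ (inj₁ o) = ⊥-elim (¬o′ o)
  ...   | inj₂ (inj₂ t) = inj₁ t

-- The top boundary

columnsFrom : ∀ {k} → Vec ℕ k → ℕ → (w : ℕ) → Vec (Label k) w
columnsFrom lam s zero    = []
columnsFrom lam s (suc w) = mapV (_≡ᵇ s) lam ∷ columnsFrom lam (suc s) w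

tabulate-columnsFrom : ∀ {k} (lam : Vec ℕ k) s w →
                       tabulate {n = w} (λ i → mapV (_≡ᵇ (s +ℕ toℕ i)) lam) ≡ columnsFrom lam s w
tabulate-columnsFrom lam s zero    = P.refl
tabulate-columnsFrom lam s (suc w) =
  cong₂ _∷_ (cong (λ z → mapV (_≡ᵇ z) lam) (ℕₚ.+-identityʳ s))
    (P.trans (Vecₚ.tabulate-cong (λ i → cong (λ z → mapV (_≡ᵇ z) lam) (ℕₚ.+-suc s (toℕ i))))
             (tabulate-columnsFrom lam (suc s) w))

swapColours-columnsFrom : ∀ {k} c (lam : Vec ℕ k) s w →
                          swapColours c (columnsFrom lam s w) ≡ columnsFrom (swapAt c lam) s w
swapColours-columnsFrom c lam s zero    = P.refl
swapColours-columnsFrom c lam s (suc w) =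
  cong₂ _∷_ (P.sym (map-swapAt (_≡ᵇ s) c lam)) (swapColours-columnsFrom c lam (suc s) w)

≡⇒≡ᵇ-true : ∀ {m n} → m ≡ n → (m ≡ᵇ n) ≡ true
≡⇒≡ᵇ-true {zero}  P.refl = P.refl
≡⇒≡ᵇ-true {suc m} P.refl = ≡⇒≡ᵇ-true {m} P.refl

≢⇒≡ᵇ-false : ∀ {m n} → m ≢ n → (m ≡ᵇ n) ≡ false
≢⇒≡ᵇ-false {zero}  {zero}  m≢n = ⊥-elim (m≢n P.refl)
≢⇒≡ᵇ-false {zero}  {suc n} m≢n = P.refl
≢⇒≡ᵇ-false {suc m} {zero}  m≢n = P.refl
≢⇒≡ᵇ-false {suc m} {suc n} m≢n = ≢⇒≡ᵇ-false (λ e → m≢n (cong suc e))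

module TopColumns {k : ℕ} (c : ℕ) (c+1<k : suc c < k) (lam : Vec ℕ k) where
  open TwoColours c c+1<k

  private
    a b : ℕ
    a = entry c lam
    b = entry (suc c) lam

    here-at : ∀ s → bit c (mapV (_≡ᵇ s) lam) ≡ (a ≡ᵇ s)
    here-at s = bit-map (_≡ᵇ s) c lam (ℕₚ.<-trans (ℕₚ.n<1+n c) c+1<k)

    next-at : ∀ s → bit (suc c) (mapV (_≡ᵇ s) lam) ≡ (b ≡ᵇ s)
    next-at s = bit-map (_≡ᵇ s) (suc c) lam c+1<k

  Clear-columnsFrom : ∀ s w → a < s → b < s → Clear (columnsFrom lam s w)
  Clear-columnsFrom s zero    a<s b<s = clear[]
  Clear-columnsFrom s (suc w) a<s b<s =
    clear∷ (P.trans (here-at s) (≢⇒≡ᵇ-false (ℕₚ.<⇒≢ a<s))) (P.trans (next-at s) (≢⇒≡ᵇ-false (ℕₚ.<⇒≢ b<s)))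
           (Clear-columnsFrom (suc s) w (ℕₚ.m<n⇒m<1+n a<s) (ℕₚ.m<n⇒m<1+n b<s))

  NextOnly-columnsFrom : ∀ s w → a < s → s ≤ b → b < s +ℕ w → NextOnly (columnsFrom lam s w)
  NextOnly-columnsFrom s zero    a<s s≤b b<s+0 = ⊥-elim (ℕₚ.<⇒≱ (P.subst (b <_) (ℕₚ.+-identityʳ s) b<s+0) s≤b)
  NextOnly-columnsFrom s (suc w) a<s s≤b b<s+w with ℕₚ.m≤n⇒m<n∨m≡n s≤b
  ... | inj₁ s<b = next-skip (P.trans (here-at s) (≢⇒≡ᵇ-false (ℕₚ.<⇒≢ a<s)))
                             (P.trans (next-at s) (≢⇒≡ᵇ-false (ℕₚ.>⇒≢ s<b)))
                     (NextOnly-columnsFrom (suc s) w (ℕₚ.m<n⇒m<1+n a<s) s<b (P.subst (b <_) (ℕₚ.+-suc s w) b<s+w))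
  ... | inj₂ P.refl = next-here (P.trans (here-at s) (≢⇒≡ᵇ-false (ℕₚ.<⇒≢ a<s)))
                                (P.trans (next-at s) (≡⇒≡ᵇ-true {b} P.refl))
                        (Clear-columnsFrom (suc s) w (ℕₚ.m<n⇒m<1+n a<s) (ℕₚ.n<1+n s))

  Ordered-columnsFrom : ∀ s w → s ≤ a → a < b → b < s +ℕ w → Ordered (columnsFrom lam s w)
  Ordered-columnsFrom s zero    s≤a a<b b<s+0 =
    ⊥-elim (ℕₚ.<⇒≱ (P.subst (b <_) (ℕₚ.+-identityʳ s) b<s+0) (ℕₚ.≤-trans s≤a (ℕₚ.<⇒≤ a<b)))
  Ordered-columnsFrom s (suc w) s≤a a<b b<s+w with ℕₚ.m≤n⇒m<n∨m≡n s≤a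
  ... | inj₁ s<a = ord-skip (P.trans (here-at s) (≢⇒≡ᵇ-false (ℕₚ.>⇒≢ s<a)))
                            (P.trans (next-at s) (≢⇒≡ᵇ-false (ℕₚ.>⇒≢ (ℕₚ.<-trans s<a a<b))))
                     (Ordered-columnsFrom (suc s) w s<a a<b (P.subst (b <_) (ℕₚ.+-suc s w) b<s+w))
  ... | inj₂ P.refl = ord-here (P.trans (here-at s) (≡⇒≡ᵇ-true {a} P.refl))
                               (P.trans (next-at s) (≢⇒≡ᵇ-false (ℕₚ.>⇒≢ a<b)))
                        (NextOnly-columnsFrom (suc s) w (ℕₚ.n<1+n s) a<b (P.subst (b <_) (ℕₚ.+-suc s w) b<s+w))

whiteμ : ∀ {k} → Label k → Label k → Label k → Vec ℕ k
whiteμ I J K = toN I +ᵛ toN J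

whiteQ : ∀ {k} → Label k → Label k → Label k → Bool
whiteQ I J K = allB (zipWith (λ i j → not (i ∧ j)) I J)

purpleμ : ∀ {k} → Label k → Label k → Label k → Vec ℕ k
purpleμ I J K = toN K ∸ᵛ toN J

purpleQ : ∀ {k} → Label k → Label k → Label k → Bool
purpleQ I J K = allB (zipWith (λ kc jc → b2n jc ≤ᵇ b2n kc) K J)

whiteμ-swapAt : ∀ {k} c (I J K : Label k) → whiteμ (swapAt c I) (swapAt c J) (swapAt c K) ≡ swapAt c (whiteμ I J K)
whiteμ-swapAt c I J K = P.trans (cong₂ _+ᵛ_ (map-swapAt b2n c I) (map-swapAt b2n c J)) (zipWith-swapAt _+ℕ_ c (toN I) (toN J))

whiteQ-swapAt : ∀ {k} c (I J K : Label k) → whiteQ (swapAt c I) (swapAt c J) (swapAt c K) ≡ whiteQ I J K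
whiteQ-swapAt c I J K = P.trans (cong allB (zipWith-swapAt _ c I J)) (allB-swapAt c _)

purpleμ-swapAt : ∀ {k} c (I J K : Label k) → purpleμ (swapAt c I) (swapAt c J) (swapAt c K) ≡ swapAt c (purpleμ I J K)
purpleμ-swapAt c I J K = P.trans (cong₂ _∸ᵛ_ (map-swapAt b2n c K) (map-swapAt b2n c J)) (zipWith-swapAt _∸_ c (toN K) (toN J))

purpleQ-swapAt : ∀ {k} c (I J K : Label k) → purpleQ (swapAt c I) (swapAt c J) (swapAt c K) ≡ purpleQ I J K
purpleQ-swapAt c I J K = P.trans (cong allB (zipWith-swapAt _ c K J)) (allB-swapAt c _)

entry-whiteμ : ∀ {k} j (I J K : Label k) → entry j (whiteμ I J K) ≡ b2n (bit j I) +ℕ b2n (bit j J)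
entry-whiteμ j I J K = P.trans (entry-+ᵛ j (toN I) (toN J)) (cong₂ _+ℕ_ (entry-toN j I) (entry-toN j J))

entry-purpleμ : ∀ {k} j (I J K : Label k) → entry j (purpleμ I J K) ≡ b2n (bit j K) ∸ b2n (bit j J)
entry-purpleμ j I J K = P.trans (entry-∸ᵛ j (toN K) (toN J)) (cong₂ _∸_ (entry-toN j K) (entry-toN j J))

whiteμ-absent : ∀ {k} j (I J K : Label k) → bit j I ≡ false → bit j J ≡ false → bit j K ≡ false →
                entry j (whiteμ I J K) ≡ 0
whiteμ-absent j I J K I-absent J-absent _ = P.trans (entry-whiteμ j I J K) (cong₂ (λ p q → b2n p +ℕ b2n q) I-absent J-absent)

purpleμ-absent : ∀ {k} j (I J K : Label k) → bit j I ≡ false → bit j J ≡ false → bit j K ≡ false →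
                 entry j (purpleμ I J K) ≡ 0
purpleμ-absent j I J K _ J-absent K-absent = P.trans (entry-purpleμ j I J K) (cong₂ (λ p q → b2n p ∸ b2n q) K-absent J-absent)

whiteμ-here : ∀ {k} c (I J K : Label k) → bit c I ≡ true → bit c J ≡ false → bit c K ≡ true →
              entry c (whiteμ I J K) ≡ 1
whiteμ-here c I J K I-present J-absent _ = P.trans (entry-whiteμ c I J K) (cong₂ (λ p q → b2n p +ℕ b2n q) I-present J-absent)

purpleμ-here : ∀ {k} c (I J K : Label k) → bit c I ≡ true → bit c J ≡ false → bit c K ≡ true →
               entry c (purpleμ I J K) ≡ 1
purpleμ-here c I J K _ J-absent K-present = P.trans (entry-purpleμ c I J K) (cong₂ (λ p q → b2n p ∸ b2n q) K-present J-absent)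

-- Partition functions over a commutative ring

module _ {r ℓ} (R : CommutativeRing r ℓ) where
  open CommutativeRing R
  open import Relation.Binary.Reasoning.Setoid setoid
  open import Algebra.Solver.Ring.NaturalCoefficients.Default commutativeSemiring

  zero-*ˡ : ∀ {a b} → a ≈ 0# → a * b ≈ 0#
  zero-*ˡ a≈0 = trans (*-cong a≈0 refl) (zeroˡ _)

  ∑ : ∀ {a} {A : Set a} → List A → (A → Carrier) → Carrier
  ∑ xs f = sumL R (mapL f xs)

  ∑-cong : ∀ {a} {A : Set a} (xs : List A) {f g : A → Carrier} → (∀ x → f x ≈ g x) → ∑ xs f ≈ ∑ xs g
  ∑-cong []       f≈g = refl
  ∑-cong (x ∷ xs) f≈g = +-cong (f≈g x) (∑-cong xs f≈g)

  ∑-zero : ∀ {a} {A : Set a} (xs : List A) {f : A → Carrier} → (∀ x → f x ≈ 0#) → ∑ xs f ≈ 0#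
  ∑-zero []       f≈0 = refl
  ∑-zero (x ∷ xs) f≈0 = trans (+-cong (f≈0 x) (∑-zero xs f≈0)) (+-identityʳ 0#)

  ∑-+ : ∀ {a} {A : Set a} (xs : List A) (f g : A → Carrier) → ∑ xs (λ x → f x + g x) ≈ ∑ xs f + ∑ xs g
  ∑-+ []       f g = sym (+-identityʳ 0#)
  ∑-+ (x ∷ xs) f g = trans (+-cong refl (∑-+ xs f g))
    (solve 4 (λ a b c d → (a :+ b) :+ (c :+ d) := (a :+ c) :+ (b :+ d)) refl (f x) (g x) (∑ xs f) (∑ xs g))

  ∑-*ˡ : ∀ {a} {A : Set a} (xs : List A) (s : Carrier) (f : A → Carrier) → ∑ xs (λ x → s * f x) ≈ s * ∑ xs f
  ∑-*ˡ []       s f = sym (zeroʳ s)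
  ∑-*ˡ (x ∷ xs) s f = trans (+-cong refl (∑-*ˡ xs s f)) (sym (distribˡ s (f x) (∑ xs f)))

  ∑-++ : ∀ {a} {A : Set a} (xs ys : List A) (f : A → Carrier) → ∑ (xs ++ ys) f ≈ ∑ xs f + ∑ ys f
  ∑-++ []       ys f = sym (+-identityˡ _)
  ∑-++ (x ∷ xs) ys f = trans (+-cong refl (∑-++ xs ys f)) (sym (+-assoc _ _ _))

  ∑-concatMap : ∀ {a b} {A : Set a} {B : Set b} (g : A → List B) (xs : List A) (f : B → Carrier) →
                ∑ (concatMap g xs) f ≈ ∑ xs (λ x → ∑ (g x) f)
  ∑-concatMap g []       f = refl
  ∑-concatMap g (x ∷ xs) f = trans (∑-++ (g x) (concatMap g xs) f) (+-cong refl (∑-concatMap g xs f))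

  ∑-comm : ∀ {a b} {A : Set a} {B : Set b} (xs : List A) (ys : List B) (f : A → B → Carrier) →
           ∑ xs (λ x → ∑ ys (f x)) ≈ ∑ ys (λ y → ∑ xs (λ x → f x y))
  ∑-comm []       ys f = sym (∑-zero ys (λ _ → refl))
  ∑-comm (x ∷ xs) ys f = trans (+-cong refl (∑-comm xs ys f)) (sym (∑-+ ys (f x) (λ y → ∑ xs (λ x → f x y))))

  ∑-allVecs-suc : ∀ {a} {A : Set a} (xs : List A) w (F : Vec A (suc w) → Carrier) →
                  ∑ (allVecs xs (suc w)) F ≈ ∑ (allVecs xs w) (λ v → ∑ xs (λ x → F (x ∷ v)))
  ∑-allVecs-suc xs w F = trans (∑-concatMap (λ v → mapL (_∷ v) xs) (allVecs xs w) F)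
    (∑-cong (allVecs xs w) (λ v → reflexive (cong (sumL R) (P.sym (Listₚ.map-∘ xs)))))

  ∑-allVecs-map : ∀ {a} {A : Set a} (xs : List A) (g : A → A) →
                  (∀ (f : A → Carrier) → ∑ xs (λ x → f (g x)) ≈ ∑ xs f) →
                  ∀ w (F : Vec A w → Carrier) → ∑ (allVecs xs w) (λ v → F (mapV g v)) ≈ ∑ (allVecs xs w) F
  ∑-allVecs-map xs g ∑-g zero    F = refl
  ∑-allVecs-map xs g ∑-g (suc w) F = begin
    ∑ (allVecs xs (suc w)) (λ v → F (mapV g v))             ≈⟨ ∑-allVecs-suc xs w _ ⟩
    ∑ (allVecs xs w) (λ v → ∑ xs (λ x → F (g x ∷ mapV g v)))
      ≈⟨ ∑-cong (allVecs xs w) (λ v → ∑-g (λ x → F (x ∷ mapV g v))) ⟩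
    ∑ (allVecs xs w) (λ v → ∑ xs (λ x → F (x ∷ mapV g v)))
      ≈⟨ ∑-allVecs-map xs g ∑-g w (λ v → ∑ xs (λ x → F (x ∷ v))) ⟩
    ∑ (allVecs xs w) (λ v → ∑ xs (λ x → F (x ∷ v)))          ≈⟨ ∑-allVecs-suc xs w F ⟨
    ∑ (allVecs xs (suc w)) F                                 ∎

  ∑-allLabels-swapAt : ∀ k c (f : Label k → Carrier) → ∑ (allLabels k) (λ v → f (swapAt c v)) ≈ ∑ (allLabels k) f
  ∑-allLabels-swapAt zero          zero    f = refl
  ∑-allLabels-swapAt (suc zero)    zero    f = refl
  ∑-allLabels-swapAt (suc (suc k)) zero    f = begin
    ∑ (allLabels (suc (suc k))) (λ v → f (swapAt 0 v))                       ≈⟨ ∑-allVecs-suc bools (suc k) _ ⟩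
    ∑ (allLabels (suc k)) (λ v → ∑ bools (λ x → f (swapAt 0 (x ∷ v))))      ≈⟨ ∑-allVecs-suc bools k _ ⟩
    ∑ (allLabels k) (λ v → ∑ bools (λ y → ∑ bools (λ x → f (y ∷ x ∷ v))))
      ≈⟨ ∑-cong (allLabels k) (λ v → ∑-comm bools bools (λ y x → f (y ∷ x ∷ v))) ⟩
    ∑ (allLabels k) (λ v → ∑ bools (λ x → ∑ bools (λ y → f (y ∷ x ∷ v))))    ≈⟨ ∑-allVecs-suc bools k _ ⟨
    ∑ (allLabels (suc k)) (λ v → ∑ bools (λ x → f (x ∷ v)))                 ≈⟨ ∑-allVecs-suc bools (suc k) f ⟨
    ∑ (allLabels (suc (suc k))) f                                           ∎
    where bools = false ∷ true ∷ []
  ∑-allLabels-swapAt zero          (suc c) f = refl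
  ∑-allLabels-swapAt (suc k)       (suc c) f = begin
    ∑ (allLabels (suc k)) (λ v → f (swapAt (suc c) v))          ≈⟨ ∑-allVecs-suc bools k _ ⟩
    ∑ (allLabels k) (λ v → ∑ bools (λ x → f (x ∷ swapAt c v)))
      ≈⟨ ∑-allLabels-swapAt k c (λ v → ∑ bools (λ x → f (x ∷ v))) ⟩
    ∑ (allLabels k) (λ v → ∑ bools (λ x → f (x ∷ v)))           ≈⟨ ∑-allVecs-suc bools k f ⟨
    ∑ (allLabels (suc k)) f                                     ∎
    where bools = false ∷ true ∷ []

  ∑-states-swapColours : ∀ k c w (F : Vec (Label k) w → Carrier) →
                         ∑ (allVecs (allLabels k) w) (λ vs → F (swapColours c vs)) ≈ ∑ (allVecs (allLabels k) w) F
  ∑-states-swapColours k c = ∑-allVecs-map (allLabels k) (swapAt c) (∑-allLabels-swapAt k c)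

  ∑-allLabels-single : ∀ k (h₀ : Label k) (F : Label k → Carrier) → (∀ h → h ≢ h₀ → F h ≈ 0#) →
                       ∑ (allLabels k) F ≈ F h₀
  ∑-allLabels-single zero    []       F F≈0 = +-identityʳ _
  ∑-allLabels-single (suc k) (x ∷ h₀) F F≈0 = begin
    ∑ (allLabels (suc k)) F ≈⟨ ∑-allVecs-suc bools k F ⟩
    ∑ (allLabels k) G       ≈⟨ ∑-allLabels-single k h₀ G G≈0 ⟩
    G h₀                    ≈⟨ head x P.refl ⟩
    F (x ∷ h₀)              ∎
    where
    bools = false ∷ true ∷ []
    G : Label k → Carrier
    G h = ∑ bools (λ y → F (y ∷ h))
    G≈0 : ∀ h → h ≢ h₀ → G h ≈ 0#
    G≈0 h h≢h₀ = ∑-zero bools (λ y → F≈0 (y ∷ h) (λ e → h≢h₀ (Vecₚ.∷-injectiveʳ e)))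
    head : ∀ y → y ≡ x → G h₀ ≈ F (x ∷ h₀)
    head false P.refl = trans (+-cong refl (trans (+-cong (F≈0 (true ∷ h₀) (λ ())) refl) (+-identityʳ 0#))) (+-identityʳ _)
    head true  P.refl = trans (+-cong (F≈0 (false ∷ h₀) (λ ())) (+-identityʳ _)) (+-identityˡ _)

  pow-+ : ∀ a m n → pow R a (m +ℕ n) ≈ pow R a m * pow R a n
  pow-+ a zero    n = sym (*-identityˡ _)
  pow-+ a (suc m) n = trans (*-cong refl (pow-+ a m n)) (sym (*-assoc _ _ _))

  -- White and purple weights are the instances (μ, Q) = (I + J, I and J share no colour)
  -- and (K ∸ J, J ≤ K) of the following weight.
  module Weight {k : ℕ} (t x : Carrier) (μ : Label k → Label k → Label k → Vec ℕ k)
                (Q : Label k → Label k → Label k → Bool) where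

    weight : VWeight R k
    weight I J K L = ind R (eqV (toN I +ᵛ toN J) (toN K +ᵛ toN L) ∧ Q I J K)
                     * (pow R x (size L) * pow R t (φ (toN L) (μ I J K)))

    weight-≢outflow : ∀ I J K L → L ≢ outflow I J K → weight I J K L ≈ 0#
    weight-≢outflow I J K L L≢ with eqV (toN I +ᵛ toN J) (toN K +ᵛ toN L) in balanced
    ... | true  = ⊥-elim (L≢ (balanced⇒outflow I J K L balanced))
    ... | false = zeroˡ _

    weight-unbalanced : ∀ j I J K L → b2n (bit j I) +ℕ b2n (bit j J) ≢ b2n (bit j K) +ℕ b2n (bit j L) →
                        weight I J K L ≈ 0#
    weight-unbalanced j I J K L unbalanced with eqV (toN I +ᵛ toN J) (toN K +ᵛ toN L) in balanced
    ... | false = zeroˡ _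
    ... | true  = ⊥-elim (unbalanced (balanced⇒bit-balanced j I J K L balanced))

    weight-forbidden : ∀ I J K L → Q I J K ≡ false → weight I J K L ≈ 0#
    weight-forbidden I J K L forbidden =
      trans (*-cong (reflexive (cong (ind R) (P.trans (cong (_ ∧_) forbidden) (Boolₚ.∧-zeroʳ _)))) refl) (zeroˡ _)

    weight-emerging : ∀ j I J K L → bit j I ≡ false → bit j J ≡ false → bit j K ≡ true → weight I J K L ≈ 0#
    weight-emerging j I J K L I-absent J-absent K-present = weight-unbalanced j I J K L unbalanced
      where
      unbalanced : b2n (bit j I) +ℕ b2n (bit j J) ≢ b2n (bit j K) +ℕ b2n (bit j L)
      unbalanced e rewrite I-absent | J-absent | K-present with e
      ... | ()

    row : ∀ {w} → Label k → Vec (Label k) w → Vec (Label k) w → Carrier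
    row = rowW R weight

    row-step : ∀ {w} h b u (bs us : Vec (Label k) w) →
               row h (b ∷ bs) (u ∷ us) ≈ weight b h u (outflow b h u) * row (outflow b h u) bs us
    row-step h b u bs us = ∑-allLabels-single k (outflow b h u) (λ h′ → weight b h u h′ * row h′ bs us)
      (λ h′ h′≢ → trans (*-cong (weight-≢outflow b h u h′ h′≢) refl) (zeroˡ _))

    row-unbalanced : ∀ {w} j h (bs us : Vec (Label k) w) → b2n (bit j h) +ℕ count j bs ≢ count j us → row h bs us ≈ 0#
    row-unbalanced j h [] [] unbalanced with bit j h in h-carries
    ... | false = ⊥-elim (unbalanced P.refl)
    ... | true  = reflexive (cong (ind R) (eqL-empty-false j h h-carries))
    row-unbalanced j h (b ∷ bs) (u ∷ us) unbalanced = trans (row-step h b u bs us) vanish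
      where
      h′ = outflow b h u
      vanish : weight b h u h′ * row h′ bs us ≈ 0#
      vanish with b2n (bit j b) +ℕ b2n (bit j h) ≟ b2n (bit j u) +ℕ b2n (bit j h′)
      ... | no  vertex-unbalanced = trans (*-cong (weight-unbalanced j b h u h′ vertex-unbalanced) refl) (zeroˡ _)
      ... | yes vertex-balanced =
        trans (*-cong refl (row-unbalanced j h′ bs us
                 (λ rest → unbalanced (+-balance-trans {b2n (bit j b)} {b2n (bit j h)} vertex-balanced rest))))
              (zeroʳ _)

    module Swap (c : ℕ) (c+1<k : suc c < k)
      (μ-swapAt : ∀ I J K → μ (swapAt c I) (swapAt c J) (swapAt c K) ≡ swapAt c (μ I J K))
      (Q-swapAt : ∀ I J K → Q (swapAt c I) (swapAt c J) (swapAt c K) ≡ Q I J K)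
      (μ-absent : ∀ j I J K → bit j I ≡ false → bit j J ≡ false → bit j K ≡ false → entry j (μ I J K) ≡ 0) where
      open TwoColours c c+1<k

      sw : ∀ {a} {A : Set a} → Vec A k → Vec A k
      sw = swapAt c

      sws : ∀ {w} → Vec (Label k) w → Vec (Label k) w
      sws = swapColours c

      weight-swapAt : ∀ I J K L →
        weight (sw I) (sw J) (sw K) (sw L) * pow R t (entry c (toN L) *ℕ entry (suc c) (μ I J K))
        ≈ weight I J K L * pow R t (entry (suc c) (toN L) *ℕ entry c (μ I J K))
      weight-swapAt I J K L = begin
        weight (sw I) (sw J) (sw K) (sw L) * pow R t e₁
          ≡⟨ cong₂ (λ a s → ind R a * (pow R x s * pow R t (φ (toN (sw L)) (μ (sw I) (sw J) (sw K)))) * pow R t e₁)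
                   (cong₂ _∧_ (balance-swapAt c I J K L) (Q-swapAt I J K)) (size-swapAt c L) ⟩
        ind R B * (pow R x (size L) * pow R t (φ (toN (sw L)) (μ (sw I) (sw J) (sw K)))) * pow R t e₁
          ≡⟨ cong (λ z → ind R B * (pow R x (size L) * pow R t z) * pow R t e₁)
                  (cong₂ φ (map-swapAt b2n c L) (μ-swapAt I J K)) ⟩
        ind R B * (pow R x (size L) * pow R t (φ (sw (toN L)) (sw (μ I J K)))) * pow R t e₁
          ≈⟨ reassoc ⟩
        ind R B * (pow R x (size L) * (pow R t (φ (sw (toN L)) (sw (μ I J K))) * pow R t e₁))
          ≈⟨ *-cong refl (*-cong refl (pow-+ t (φ (sw (toN L)) (sw (μ I J K))) e₁)) ⟨
        ind R B * (pow R x (size L) * pow R t (φ (sw (toN L)) (sw (μ I J K)) +ℕ e₁))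
          ≡⟨ cong (λ z → ind R B * (pow R x (size L) * pow R t z)) (φ-swapAt c (toN L) (μ I J K)) ⟩
        ind R B * (pow R x (size L) * pow R t (φ (toN L) (μ I J K) +ℕ e₂))
          ≈⟨ *-cong refl (*-cong refl (pow-+ t (φ (toN L) (μ I J K)) e₂)) ⟩
        ind R B * (pow R x (size L) * (pow R t (φ (toN L) (μ I J K)) * pow R t e₂))
          ≈⟨ reassoc ⟨
        weight I J K L * pow R t e₂ ∎
        where
        e₁ = entry c (toN L) *ℕ entry (suc c) (μ I J K)
        e₂ = entry (suc c) (toN L) *ℕ entry c (μ I J K)
        B = eqV (toN I +ᵛ toN J) (toN K +ᵛ toN L) ∧ Q I J K
        reassoc : ∀ {a b e f} → a * (b * e) * f ≈ a * (b * (e * f))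
        reassoc {a} {b} {e} {f} = solve 4 (λ a b e f → a :* (b :* e) :* f := a :* (b :* (e :* f))) refl a b e f

      weight-swap-exponent : ∀ I J K L → entry c (toN L) *ℕ entry (suc c) (μ I J K) ≡ 0 →
        weight (sw I) (sw J) (sw K) (sw L) ≈ weight I J K L * pow R t (entry (suc c) (toN L) *ℕ entry c (μ I J K))
      weight-swap-exponent I J K L e₁ =
        trans (sym (*-identityʳ _)) (trans (*-cong refl (reflexive (cong (pow R t) (P.sym e₁)))) (weight-swapAt I J K L))

      weight-swap-invariant : ∀ I J K L → entry c (toN L) *ℕ entry (suc c) (μ I J K) ≡ 0 →
                              entry (suc c) (toN L) *ℕ entry c (μ I J K) ≡ 0 →
                              weight (sw I) (sw J) (sw K) (sw L) ≈ weight I J K L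
      weight-swap-invariant I J K L e₁ e₂ =
        trans (weight-swap-exponent I J K L e₁) (trans (*-cong refl (reflexive (cong (pow R t) e₂))) (*-identityʳ _))

      weight-swap-crossing : ∀ I J K L → entry c (toN L) *ℕ entry (suc c) (μ I J K) ≡ 0 →
                             entry (suc c) (toN L) *ℕ entry c (μ I J K) ≡ 1 →
                             weight (sw I) (sw J) (sw K) (sw L) ≈ t * weight I J K L
      weight-swap-crossing I J K L e₁ e₂ = trans (weight-swap-exponent I J K L e₁)
        (trans (*-cong refl (trans (reflexive (cong (pow R t) e₂)) (*-identityʳ t))) (*-comm _ _))

      row-swap-Without-next : ∀ {w} h (bs us : Vec (Label k) w) → bit (suc c) h ≡ false →
                              Without (suc c) bs → Without (suc c) us → row (sw h) (sws bs) (sws us) ≈ row h bs us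
      row-swap-Without-next h []       []       _ _ _ = reflexive (cong (ind R) (eqL-empty-swapAt c h))
      row-swap-Without-next h (b ∷ bs) (u ∷ us) h-absent (b-absent , bs-absent) (u-absent , us-absent) = begin
        row (sw h) (sw b ∷ sws bs) (sw u ∷ sws us)
          ≈⟨ row-step (sw h) (sw b) (sw u) (sws bs) (sws us) ⟩
        weight (sw b) (sw h) (sw u) (outflow (sw b) (sw h) (sw u)) * row (outflow (sw b) (sw h) (sw u)) (sws bs) (sws us)
          ≡⟨ cong (λ z → weight (sw b) (sw h) (sw u) z * row z (sws bs) (sws us)) (outflow-swapAt c b h u) ⟩
        weight (sw b) (sw h) (sw u) (sw h′) * row (sw h′) (sws bs) (sws us)
          ≈⟨ *-cong (weight-swap-invariant b h u h′ e₁ e₂) (row-swap-Without-next h′ bs us h′-absent bs-absent us-absent) ⟩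
        weight b h u h′ * row h′ bs us
          ≈⟨ row-step h b u bs us ⟨
        row h (b ∷ bs) (u ∷ us) ∎
        where
        h′ = outflow b h u
        h′-absent : bit (suc c) h′ ≡ false
        h′-absent = bit-outflow-of (suc c) b h u b-absent h-absent u-absent
        e₁ : entry c (toN h′) *ℕ entry (suc c) (μ b h u) ≡ 0
        e₁ = *-≡0ʳ (entry c (toN h′)) (μ-absent (suc c) b h u b-absent h-absent u-absent)
        e₂ : entry (suc c) (toN h′) *ℕ entry c (μ b h u) ≡ 0
        e₂ = entry-toN-absent-* (suc c) h′ h′-absent

      row-swap-Without-c : ∀ {w} h (bs us : Vec (Label k) w) → bit c h ≡ false →
                           Without c bs → Without c us → row (sw h) (sws bs) (sws us) ≈ row h bs us
      row-swap-Without-c h bs us h-absent bs-absent us-absent = sym (begin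
        row h bs us
          ≡⟨ cong₂ (λ h′ (vs : _ × _) → row h′ (proj₁ vs) (proj₂ vs)) (swapAt-involutive c h)
                   (cong₂ _,_ (swapColours-involutive c bs) (swapColours-involutive c us)) ⟨
        row (sw (sw h)) (sws (sws bs)) (sws (sws us))
          ≈⟨ row-swap-Without-next (sw h) (sws bs) (sws us) (swapped-next h h-absent)
               (Without-swapColours bs bs-absent) (Without-swapColours us us-absent) ⟩
        row (sw h) (sws bs) (sws us) ∎)

      RowExchange : ∀ {w} → Label k → Vec (Label k) w → Vec (Label k) w → Set ℓ
      RowExchange h bs us = t * row h bs us + t * (t * row (sw h) (sws bs) us)
                            ≈ row h bs (sws us) + t * row (sw h) (sws bs) (sws us)

      exchange-via : ∀ {w} {h : Label k} {bs us : Vec (Label k) w} {X₁ X₂ X₃ X₄ : Carrier} →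
                     row h bs us ≈ X₁ → row (sw h) (sws bs) us ≈ X₂ →
                     row h bs (sws us) ≈ X₃ → row (sw h) (sws bs) (sws us) ≈ X₄ →
                     t * X₁ + t * (t * X₂) ≈ X₃ + t * X₄ → RowExchange h bs us
      exchange-via e₁ e₂ e₃ e₄ e =
        trans (+-cong (*-cong refl e₁) (*-cong refl (*-cong refl e₂))) (trans e (sym (+-cong e₃ (*-cong refl e₄))))

      module FirstVertex {w} (h b u : Label k) (bs us : Vec (Label k) w) where
        h₁ : Label k
        h₁ = outflow b h u

        v₁ : Carrier
        v₁ = weight b h u h₁

        expand : row h (b ∷ bs) (u ∷ us) ≈ v₁ * row h₁ bs us
        expand = row-step h b u bs us

        expand-bottom-swapped : row (sw h) (sw b ∷ sws bs) (u ∷ us)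
          ≈ weight (sw b) (sw h) u (outflow (sw b) (sw h) u) * row (outflow (sw b) (sw h) u) (sws bs) us
        expand-bottom-swapped = row-step (sw h) (sw b) u (sws bs) us

        expand-top-swapped : row h (b ∷ bs) (sw u ∷ sws us)
          ≈ weight b h (sw u) (outflow b h (sw u)) * row (outflow b h (sw u)) bs (sws us)
        expand-top-swapped = row-step h b (sw u) bs (sws us)

        expand-both-swapped : row (sw h) (sw b ∷ sws bs) (sw u ∷ sws us)
          ≈ weight (sw b) (sw h) (sw u) (sw h₁) * row (sw h₁) (sws bs) (sws us)
        expand-both-swapped = trans (row-step (sw h) (sw b) (sw u) (sws bs) (sws us))
          (reflexive (cong (λ z → weight (sw b) (sw h) (sw u) z * row z (sws bs) (sws us)) (outflow-swapAt c b h u)))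

      scale-exchange : ∀ v A B C D → t * A + t * (t * B) ≈ C + t * D →
                       t * (v * A) + t * (t * (v * B)) ≈ v * C + t * (v * D)
      scale-exchange v A B C D e = begin
        t * (v * A) + t * (t * (v * B))
          ≈⟨ solve 5 (λ t v A B C → t :* (v :* A) :+ t :* (t :* (v :* B)) := v :* (t :* A :+ t :* (t :* B))) refl t v A B C ⟩
        v * (t * A + t * (t * B)) ≈⟨ *-cong refl e ⟩
        v * (C + t * D)
          ≈⟨ solve 4 (λ t v C D → v :* (C :+ t :* D) := v :* C :+ t :* (v :* D)) refl t v C D ⟩
        v * C + t * (v * D) ∎

      exchange-pass : ∀ {w} h b u (bs us : Vec (Label k) w) → sw u ≡ u →
                      entry c (toN (outflow b h u)) *ℕ entry (suc c) (μ b h u) ≡ 0 →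
                      entry (suc c) (toN (outflow b h u)) *ℕ entry c (μ b h u) ≡ 0 →
                      RowExchange (outflow b h u) bs us → RowExchange h (b ∷ bs) (u ∷ us)
      exchange-pass h b u bs us u-fixed e₁ e₂ rest =
        exchange-via {h = h} {bs = b ∷ bs} {us = u ∷ us} expand bottom-swapped top-swapped
          (trans expand-both-swapped (*-cong v₁-invariant refl)) (scale-exchange v₁ _ _ _ _ rest)
        where
        open FirstVertex h b u bs us
        v₁-invariant : weight (sw b) (sw h) (sw u) (sw h₁) ≈ v₁
        v₁-invariant = weight-swap-invariant b h u h₁ e₁ e₂
        bottom-swapped : row (sw h) (sw b ∷ sws bs) (u ∷ us) ≈ v₁ * row (sw h₁) (sws bs) us
        bottom-swapped = begin
          row (sw h) (sw b ∷ sws bs) (u ∷ us)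
            ≡⟨ cong (λ z → row (sw h) (sw b ∷ sws bs) (z ∷ us)) u-fixed ⟨
          row (sw h) (sw b ∷ sws bs) (sw u ∷ us)
            ≈⟨ row-step (sw h) (sw b) (sw u) (sws bs) us ⟩
          weight (sw b) (sw h) (sw u) (outflow (sw b) (sw h) (sw u)) * row (outflow (sw b) (sw h) (sw u)) (sws bs) us
            ≡⟨ cong (λ z → weight (sw b) (sw h) (sw u) z * row z (sws bs) us) (outflow-swapAt c b h u) ⟩
          weight (sw b) (sw h) (sw u) (sw h₁) * row (sw h₁) (sws bs) us
            ≈⟨ *-cong v₁-invariant refl ⟩
          v₁ * row (sw h₁) (sws bs) us ∎
        top-swapped : row h (b ∷ bs) (sw u ∷ sws us) ≈ v₁ * row h₁ bs (sws us)
        top-swapped = trans (reflexive (cong (λ z → row h (b ∷ bs) (z ∷ sws us)) u-fixed)) (row-step h b u bs (sws us))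

      exchange-exit : ∀ {w} h b u (bs us : Vec (Label k) w) → bit c (outflow b h u) ≡ false →
                      entry (suc c) (toN (outflow b h u)) *ℕ entry c (μ b h u) ≡ 0 → Without c bs → Without c us →
                      weight (sw b) (sw h) u (outflow (sw b) (sw h) u) ≈ 0# → weight b h (sw u) (outflow b h (sw u)) ≈ 0# →
                      RowExchange h (b ∷ bs) (u ∷ us)
      exchange-exit h b u bs us h₁-absent e₂ bs-absent us-absent vanish₂ vanish₃ =
        exchange-via {h = h} {bs = b ∷ bs} {us = u ∷ us} expand
          (trans expand-bottom-swapped (zero-*ˡ vanish₂)) (trans expand-top-swapped (zero-*ˡ vanish₃))
          (trans expand-both-swapped (*-cong v₁-invariant (row-swap-Without-c h₁ bs us h₁-absent bs-absent us-absent)))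
          (solve 2 (λ t X → t :* X :+ t :* (t :* con 0) := con 0 :+ t :* X) refl t (v₁ * row h₁ bs us))
        where
        open FirstVertex h b u bs us
        v₁-invariant : weight (sw b) (sw h) (sw u) (sw h₁) ≈ v₁
        v₁-invariant = weight-swap-invariant b h u h₁ (entry-toN-absent-* c h₁ h₁-absent) e₂

      exchange-vanish : ∀ {w} h b u (bs us : Vec (Label k) w) → weight b h u (outflow b h u) ≈ 0# →
                        weight (sw b) (sw h) u (outflow (sw b) (sw h) u) ≈ 0# → weight b h (sw u) (outflow b h (sw u)) ≈ 0# →
                        weight (sw b) (sw h) (sw u) (sw (outflow b h u)) ≈ 0# → RowExchange h (b ∷ bs) (u ∷ us)
      exchange-vanish h b u bs us vanish₁ vanish₂ vanish₃ vanish₄ =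
        exchange-via {h = h} {bs = b ∷ bs} {us = u ∷ us}
          (trans expand (zero-*ˡ vanish₁)) (trans expand-bottom-swapped (zero-*ˡ vanish₂))
          (trans expand-top-swapped (zero-*ˡ vanish₃)) (trans expand-both-swapped (zero-*ˡ vanish₄))
          (solve 1 (λ t → t :* con 0 :+ t :* (t :* con 0) := con 0 :+ t :* con 0) refl t)
        where open FirstVertex h b u bs us

      tied-exchange-skip : ∀ {w} h b u (bs us : Vec (Label k) w) → bit c u ≡ false → bit (suc c) u ≡ false →
                           t * row (outflow b h u) bs us ≈ row (outflow b h u) bs (sws us) →
                           t * row h (b ∷ bs) (u ∷ us) ≈ row h (b ∷ bs) (sw u ∷ sws us)
      tied-exchange-skip h b u bs us u-here u-next rest = begin
        t * row h (b ∷ bs) (u ∷ us)    ≈⟨ *-cong refl expand ⟩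
        t * (v₁ * row h₁ bs us)        ≈⟨ solve 3 (λ t v A → t :* (v :* A) := v :* (t :* A)) refl t v₁ (row h₁ bs us) ⟩
        v₁ * (t * row h₁ bs us)        ≈⟨ *-cong refl rest ⟩
        v₁ * row h₁ bs (sws us)        ≈⟨ row-step h b u bs (sws us) ⟨
        row h (b ∷ bs) (u ∷ sws us)    ≡⟨ cong (λ z → row h (b ∷ bs) (z ∷ sws us)) (fixed-by-swap u u-here u-next) ⟨
        row h (b ∷ bs) (sw u ∷ sws us) ∎
        where open FirstVertex h b u bs us

      tied-exchange-crossing : ∀ {w} h b u (bs us : Vec (Label k) w) → sw b ≡ b → sw h ≡ h →
                               bit c (outflow b h u) ≡ false → bit (suc c) (outflow b h u) ≡ true →
                               entry c (μ b h u) ≡ 1 → Clear bs → NextOnly us →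
                               t * row h (b ∷ bs) (u ∷ us) ≈ row h (b ∷ bs) (sw u ∷ sws us)
      tied-exchange-crossing h b u bs us b-fixed h-fixed h₁-here h₁-next μ-here clear next-only = begin
        t * row h (b ∷ bs) (u ∷ us)  ≈⟨ *-cong refl expand ⟩
        t * (v₁ * row h₁ bs us)      ≈⟨ *-assoc _ _ _ ⟨
        (t * v₁) * row h₁ bs us
          ≈⟨ *-cong crossing (row-swap-Without-c h₁ bs us h₁-here (Clear⇒Without-c clear) (NextOnly⇒Without-c next-only)) ⟨
        weight (sw b) (sw h) (sw u) (sw h₁) * row (sw h₁) (sws bs) (sws us)
          ≡⟨ cong₂ (λ b′ h′ → weight b′ h′ (sw u) (sw h₁) * row (sw h₁) (sws bs) (sws us)) b-fixed h-fixed ⟩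
        weight b h (sw u) (sw h₁) * row (sw h₁) (sws bs) (sws us)
          ≡⟨ cong (λ bs′ → weight b h (sw u) (sw h₁) * row (sw h₁) bs′ (sws us)) (Clear-fixed clear) ⟩
        weight b h (sw u) (sw h₁) * row (sw h₁) bs (sws us)
          ≡⟨ cong (λ z → weight b h (sw u) z * row z bs (sws us)) outflow-top-swapped ⟨
        weight b h (sw u) (outflow b h (sw u)) * row (outflow b h (sw u)) bs (sws us)
          ≈⟨ expand-top-swapped ⟨
        row h (b ∷ bs) (sw u ∷ sws us) ∎
        where
        open FirstVertex h b u bs us
        crossing : weight (sw b) (sw h) (sw u) (sw h₁) ≈ t * v₁
        crossing = weight-swap-crossing b h u h₁ (entry-toN-absent-* c h₁ h₁-here)
          (cong₂ _*ℕ_ (entry-toN-of (suc c) h₁ h₁-next) μ-here)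
        outflow-top-swapped : outflow b h (sw u) ≡ sw h₁
        outflow-top-swapped =
          P.trans (cong₂ (λ b′ h′ → outflow b′ h′ (sw u)) (P.sym b-fixed) (P.sym h-fixed)) (outflow-swapAt c b h u)

      module TiedExchange
        (carrying-both-exchange : ∀ {w} h (bs us : Vec (Label k) w) → bit c h ≡ true → bit (suc c) h ≡ true →
                                  Clear bs → Ordered us → t * row h bs us ≈ row h bs (sws us))
        (μ-here : ∀ b h u → bit c b ≡ true → bit c h ≡ false → bit c u ≡ true → entry c (μ b h u) ≡ 1) where

        tied-exchange : ∀ {w} h (bs us : Vec (Label k) w) → bit c h ≡ false → bit (suc c) h ≡ false →
                        Tied bs → Ordered us → t * row h bs us ≈ row h bs (sws us)
        tied-exchange h (b ∷ bs) (u ∷ us) h-here h-next (tied-skip b-here b-next tied) (ord-skip u-here u-next ordered) =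
          tied-exchange-skip h b u bs us u-here u-next
            (tied-exchange (outflow b h u) bs us (bit-outflow-of c b h u b-here h-here u-here)
                           (bit-outflow-of (suc c) b h u b-next h-next u-next) tied ordered)
        tied-exchange h (b ∷ bs) (u ∷ us) h-here h-next (tied-skip b-here b-next _) (ord-here u-here _ _) =
          trans (*-cong refl (trans expand (zero-*ˡ (weight-emerging c b h u _ b-here h-here u-here))))
            (trans (zeroʳ t) (sym (trans expand-top-swapped
              (zero-*ˡ (weight-emerging (suc c) b h (sw u) _ b-next h-next (swapped-next u u-here))))))
          where open FirstVertex h b u bs us
        tied-exchange h (b ∷ bs) (u ∷ us) h-here h-next (tied-here b-here b-next clear) (ord-skip u-here u-next ordered) =
          tied-exchange-skip h b u bs us u-here u-next
            (carrying-both-exchange (outflow b h u) bs us (bit-outflow-of c b h u b-here h-here u-here)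
                                    (bit-outflow-of (suc c) b h u b-next h-next u-next) clear ordered)
        tied-exchange h (b ∷ bs) (u ∷ us) h-here h-next (tied-here b-here b-next clear) (ord-here u-here u-next next-only) =
          tied-exchange-crossing h b u bs us (fixed-by-swap b b-here b-next) (fixed-by-swap h h-here h-next)
            (bit-outflow-of c b h u b-here h-here u-here) (bit-outflow-of (suc c) b h u b-next h-next u-next)
            (μ-here b h u b-here h-here u-here) clear next-only

      -- The states met while scanning a row with Ordered bottom from left to right.
      data Entering {w} (h : Label k) (bs : Vec (Label k) w) : Set where
        entering-none : bit c h ≡ false → bit (suc c) h ≡ false → Ordered bs → Entering h bs
        entering-c    : bit c h ≡ true → bit (suc c) h ≡ false → NextOnly bs → Entering h bs

      exchange-skip : ∀ {w} h b u (bs us : Vec (Label k) w) → bit (suc c) h ≡ false → bit (suc c) b ≡ false →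
                      bit c u ≡ false → bit (suc c) u ≡ false →
                      RowExchange (outflow b h u) bs us → RowExchange h (b ∷ bs) (u ∷ us)
      exchange-skip h b u bs us h-next b-next u-here u-next =
        exchange-pass h b u bs us (fixed-by-swap u u-here u-next)
          (*-≡0ʳ (entry c (toN (outflow b h u))) (μ-absent (suc c) b h u b-next h-next u-next))
          (entry-toN-absent-* (suc c) (outflow b h u) (bit-outflow-of (suc c) b h u b-next h-next u-next))

      exchange-emerging : ∀ {w} h b u (bs us : Vec (Label k) w) → bit c h ≡ false → bit (suc c) h ≡ false →
                          bit c b ≡ false → bit (suc c) b ≡ false → bit c u ≡ true → RowExchange h (b ∷ bs) (u ∷ us)
      exchange-emerging h b u bs us h-here h-next b-here b-next u-here =
        exchange-vanish h b u bs us (weight-emerging c b h u _ b-here h-here u-here)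
          (weight-emerging c (sw b) (sw h) u _ (swapped-here b b-next) (swapped-here h h-next) u-here)
          (weight-emerging (suc c) b h (sw u) _ b-next h-next (swapped-next u u-here))
          (weight-emerging (suc c) (sw b) (sw h) (sw u) _ (swapped-next b b-here) (swapped-next h h-here) (swapped-next u u-here))

      exchange-c-exits : ∀ {w} h b u (bs us : Vec (Label k) w) → bit (suc c) h ≡ false → bit (suc c) b ≡ false →
                         bit c u ≡ true → bit (suc c) u ≡ false → bit c (outflow b h u) ≡ false →
                         NextOnly bs → NextOnly us → RowExchange h (b ∷ bs) (u ∷ us)
      exchange-c-exits h b u bs us h-next b-next u-here u-next h₁-here bs-next-only us-next-only =
        exchange-exit h b u bs us h₁-here
          (entry-toN-absent-* (suc c) (outflow b h u) (bit-outflow-of (suc c) b h u b-next h-next u-next))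
          (NextOnly⇒Without-c bs-next-only) (NextOnly⇒Without-c us-next-only)
          (weight-emerging c (sw b) (sw h) u _ (swapped-here b b-next) (swapped-here h h-next) u-here)
          (weight-emerging (suc c) b h (sw u) _ b-next h-next (swapped-next u u-here))

  module WhiteRow {k : ℕ} (t x : Carrier) (c : ℕ) (c+1<k : suc c < k) where
    open TwoColours c c+1<k
    open Weight {k} t x whiteμ whiteQ public
    open Swap c c+1<k (whiteμ-swapAt c) (whiteQ-swapAt c) (whiteμ-absent {k}) public

    white-weight-swap-inflow : ∀ I J K L → entry c (whiteμ I J K) ≡ entry (suc c) (whiteμ I J K) →
                               weight (sw I) (sw J) K L ≡ weight I J K L
    white-weight-swap-inflow I J K L e =
      cong₂ (λ m q → ind R (eqV m (toN K +ᵛ toN L) ∧ q) * (pow R x (size L) * pow R t (φ (toN L) m)))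
            (P.trans (whiteμ-swapAt c I J K) (swapAt-fixes-entries c _ e)) (whiteQ-swapAt c I J K)

    -- A white vertex only sees the sum of its two incoming labels.
    white-meeting : ∀ {w} h b u (bs us : Vec (Label k) w) → bit c h ≡ true → bit (suc c) h ≡ false →
                    bit c b ≡ false → bit (suc c) b ≡ true → Clear bs →
                    row (sw h) (sw b ∷ sws bs) (u ∷ us) ≈ row h (b ∷ bs) (u ∷ us)
    white-meeting h b u bs us h-here h-next b-here b-next clear = begin
      row (sw h) (sw b ∷ sws bs) (u ∷ us)
        ≈⟨ row-step (sw h) (sw b) u (sws bs) us ⟩
      weight (sw b) (sw h) u (outflow (sw b) (sw h) u) * row (outflow (sw b) (sw h) u) (sws bs) us
        ≡⟨ cong (λ z → weight (sw b) (sw h) u z * row z (sws bs) us) (outflow-swapAt-inflow c b h u inflow-fixed) ⟩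
      weight (sw b) (sw h) u (outflow b h u) * row (outflow b h u) (sws bs) us
        ≡⟨ cong₂ (λ v bs′ → v * row (outflow b h u) bs′ us)
                 (white-weight-swap-inflow b h u _ entries-equal) (Clear-fixed clear) ⟩
      weight b h u (outflow b h u) * row (outflow b h u) bs us
        ≈⟨ row-step h b u bs us ⟨
      row h (b ∷ bs) (u ∷ us) ∎
      where
      inflow-fixed : (bit c b xor bit c h) ≡ (bit (suc c) b xor bit (suc c) h)
      inflow-fixed rewrite b-here | b-next | h-here | h-next = P.refl
      entries-equal : entry c (whiteμ b h u) ≡ entry (suc c) (whiteμ b h u)
      entries-equal = P.trans (entry-whiteμ c b h u) (P.trans (cong₂ (λ p q → b2n p +ℕ b2n q) b-here h-here)
                        (P.sym (P.trans (entry-whiteμ (suc c) b h u) (cong₂ (λ p q → b2n p +ℕ b2n q) b-next h-next))))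

    white-carrying-both-exchange : ∀ {w} h (bs us : Vec (Label k) w) → bit c h ≡ true → bit (suc c) h ≡ true →
                                   Clear bs → Ordered us → t * row h bs us ≈ row h bs (sws us)
    white-carrying-both-exchange h (b ∷ bs) (u ∷ us) h-here h-next (clear∷ b-here b-next clear) (ord-skip u-here u-next ordered) =
      tied-exchange-skip h b u bs us u-here u-next
        (white-carrying-both-exchange (outflow b h u) bs us (bit-outflow-of c b h u b-here h-here u-here)
          (bit-outflow-of (suc c) b h u b-next h-next u-next) clear ordered)
    white-carrying-both-exchange h (b ∷ bs) (u ∷ us) h-here h-next (clear∷ b-here b-next clear) (ord-here u-here u-next next-only) =
      tied-exchange-crossing h b u bs us (fixed-by-swap b b-here b-next) (fixed-by-swap h h-here h-next)
        (bit-outflow-of c b h u b-here h-here u-here) (bit-outflow-of (suc c) b h u b-next h-next u-next)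
        (P.trans (entry-whiteμ c b h u) (cong₂ (λ p q → b2n p +ℕ b2n q) b-here h-here)) clear next-only

    open TiedExchange white-carrying-both-exchange (whiteμ-here c) public

    white-row-exchange : ∀ {w} h (bs us : Vec (Label k) w) → Entering h bs → Ordered us → RowExchange h bs us
    white-row-exchange h (b ∷ bs) (u ∷ us) (entering-none h-here h-next (ord-skip b-here b-next ordered))
                           (ord-skip u-here u-next us-ordered) =
      exchange-skip h b u bs us h-next b-next u-here u-next (white-row-exchange (outflow b h u) bs us
        (entering-none (bit-outflow-of c b h u b-here h-here u-here) (bit-outflow-of (suc c) b h u b-next h-next u-next) ordered) us-ordered)
    white-row-exchange h (b ∷ bs) (u ∷ us) (entering-none h-here h-next (ord-skip b-here b-next _))
                           (ord-here u-here _ _) =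
      exchange-emerging h b u bs us h-here h-next b-here b-next u-here
    white-row-exchange h (b ∷ bs) (u ∷ us) (entering-none h-here h-next (ord-here b-here b-next next-only))
                           (ord-skip u-here u-next us-ordered) =
      exchange-skip h b u bs us h-next b-next u-here u-next (white-row-exchange (outflow b h u) bs us
        (entering-c (bit-outflow-of c b h u b-here h-here u-here) (bit-outflow-of (suc c) b h u b-next h-next u-next) next-only) us-ordered)
    white-row-exchange h (b ∷ bs) (u ∷ us) (entering-none h-here h-next (ord-here b-here b-next next-only))
                           (ord-here u-here u-next us-next-only) =
      exchange-c-exits h b u bs us h-next b-next u-here u-next (bit-outflow-of c b h u b-here h-here u-here) next-only us-next-only
    white-row-exchange h (b ∷ bs) (u ∷ us) (entering-c h-here h-next (next-skip b-here b-next next-only))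
                           (ord-skip u-here u-next us-ordered) =
      exchange-skip h b u bs us h-next b-next u-here u-next (white-row-exchange (outflow b h u) bs us
        (entering-c (bit-outflow-of c b h u b-here h-here u-here) (bit-outflow-of (suc c) b h u b-next h-next u-next) next-only) us-ordered)
    white-row-exchange h (b ∷ bs) (u ∷ us) (entering-c h-here h-next (next-skip b-here b-next next-only))
                           (ord-here u-here u-next us-next-only) =
      exchange-c-exits h b u bs us h-next b-next u-here u-next (bit-outflow-of c b h u b-here h-here u-here) next-only us-next-only
    white-row-exchange h (b ∷ bs) (u ∷ us) (entering-c h-here h-next (next-here b-here b-next clear))
                                          (ord-skip u-here u-next us-ordered) =
      exchange-via {h = h} {bs = b ∷ bs} {us = u ∷ us} expand (trans (white-meeting h b u bs us h-here h-next b-here b-next clear) expand)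
        top-swapped (trans (white-meeting h b (sw u) bs (sws us) h-here h-next b-here b-next clear) top-swapped)
        (trans (solve 3 (λ t v A → t :* (v :* A) :+ t :* (t :* (v :* A)) := v :* (t :* A) :+ t :* (v :* (t :* A))) refl t v₁ (row h₁ bs us))
               (+-cong (*-cong refl carrying-both) (*-cong refl (*-cong refl carrying-both))))
      where
      open FirstVertex h b u bs us
      carrying-both : t * row h₁ bs us ≈ row h₁ bs (sws us)
      carrying-both = white-carrying-both-exchange h₁ bs us (bit-outflow-of c b h u b-here h-here u-here)
                        (bit-outflow-of (suc c) b h u b-next h-next u-next) clear us-ordered
      top-swapped : row h (b ∷ bs) (sw u ∷ sws us) ≈ v₁ * row h₁ bs (sws us)
      top-swapped = trans (reflexive (cong (λ z → row h (b ∷ bs) (z ∷ sws us)) (fixed-by-swap u u-here u-next)))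
                          (row-step h b u bs (sws us))
    white-row-exchange h (b ∷ bs) (u ∷ us) (entering-c h-here h-next (next-here b-here b-next clear))
                                          (ord-here u-here u-next us-next-only) =
      exchange-via {h = h} {bs = b ∷ bs} {us = u ∷ us} expand (trans (white-meeting h b u bs us h-here h-next b-here b-next clear) expand)
        (trans (sym (white-meeting h b (sw u) bs (sws us) h-here h-next b-here b-next clear)) both-swapped) both-swapped
        (solve 3 (λ t v A → t :* (v :* A) :+ t :* (t :* (v :* A)) := (t :* v) :* A :+ t :* ((t :* v) :* A)) refl t v₁ (row h₁ bs us))
      where
      open FirstVertex h b u bs us
      h₁-here = bit-outflow-of c b h u b-here h-here u-here
      crossing : weight (sw b) (sw h) (sw u) (sw h₁) ≈ t * v₁
      crossing = weight-swap-crossing b h u h₁ (entry-toN-absent-* c h₁ h₁-here)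
        (cong₂ _*ℕ_ (entry-toN-of (suc c) h₁ (bit-outflow-of (suc c) b h u b-next h-next u-next))
                    (P.trans (entry-whiteμ c b h u) (cong₂ (λ p q → b2n p +ℕ b2n q) b-here h-here)))
      both-swapped : row (sw h) (sw b ∷ sws bs) (sw u ∷ sws us) ≈ (t * v₁) * row h₁ bs us
      both-swapped = trans expand-both-swapped
        (*-cong crossing (row-swap-Without-c h₁ bs us h₁-here (Clear⇒Without-c clear) (NextOnly⇒Without-c us-next-only)))

  module PurpleRow {k : ℕ} (t x : Carrier) (c : ℕ) (c+1<k : suc c < k) where
    open TwoColours c c+1<k
    open Weight {k} t x purpleμ purpleQ public
    open Swap c c+1<k (purpleμ-swapAt c) (purpleQ-swapAt c) (purpleμ-absent {k}) public

    purple-weight-leaving : ∀ j I J K L → bit j J ≡ true → bit j K ≡ false → weight I J K L ≈ 0#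
    purple-weight-leaving j I J K L J-present K-absent =
      weight-forbidden I J K L (allB-zipWith-false (λ kc jc → b2n jc ≤ᵇ b2n kc) j K J forbidden J-present)
      where
      forbidden : (b2n (bit j J) ≤ᵇ b2n (bit j K)) ≡ false
      forbidden rewrite J-present | K-absent = P.refl

    purple-carrying-both-exchange : ∀ {w} h (bs us : Vec (Label k) w) → bit c h ≡ true → bit (suc c) h ≡ true →
                                    Clear bs → Ordered us → t * row h bs us ≈ row h bs (sws us)
    purple-carrying-both-exchange h (b ∷ bs) (u ∷ us) h-here h-next _ (ord-skip u-here u-next _) =
      trans (*-cong refl (trans expand (zero-*ˡ (purple-weight-leaving c b h u _ h-here u-here))))
        (trans (zeroʳ t) (sym (trans expand-top-swapped
          (zero-*ˡ (purple-weight-leaving c b h (sw u) _ h-here (swapped-here u u-next))))))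
      where open FirstVertex h b u bs us
    purple-carrying-both-exchange h (b ∷ bs) (u ∷ us) h-here h-next _ (ord-here u-here u-next _) =
      trans (*-cong refl (trans expand (zero-*ˡ (purple-weight-leaving (suc c) b h u _ h-next u-next))))
        (trans (zeroʳ t) (sym (trans expand-top-swapped
          (zero-*ˡ (purple-weight-leaving c b h (sw u) _ h-here (swapped-here u u-next))))))
      where open FirstVertex h b u bs us

    open TiedExchange purple-carrying-both-exchange (purpleμ-here c) public

    purple-exchange-vanish : ∀ {w} h b u (bs us : Vec (Label k) w) → bit c h ≡ true → bit (suc c) h ≡ false →
                             bit c u ≡ false → bit (suc c) u ≡ false → RowExchange h (b ∷ bs) (u ∷ us)
    purple-exchange-vanish h b u bs us h-here h-next u-here u-next =
      exchange-vanish h b u bs us (purple-weight-leaving c b h u _ h-here u-here)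
        (purple-weight-leaving (suc c) (sw b) (sw h) u _ (swapped-next h h-here) u-next)
        (purple-weight-leaving c b h (sw u) _ h-here (swapped-here u u-next))
        (purple-weight-leaving (suc c) (sw b) (sw h) (sw u) _ (swapped-next h h-here) (swapped-next u u-here))

    purple-row-exchange : ∀ {w} h (bs us : Vec (Label k) w) → Entering h bs → Ordered us → RowExchange h bs us
    purple-row-exchange h (b ∷ bs) (u ∷ us) (entering-none h-here h-next (ord-skip b-here b-next ordered))
                            (ord-skip u-here u-next us-ordered) =
      exchange-skip h b u bs us h-next b-next u-here u-next (purple-row-exchange (outflow b h u) bs us
        (entering-none (bit-outflow-of c b h u b-here h-here u-here) (bit-outflow-of (suc c) b h u b-next h-next u-next) ordered) us-ordered)
    purple-row-exchange h (b ∷ bs) (u ∷ us) (entering-none h-here h-next (ord-skip b-here b-next _))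
                            (ord-here u-here _ _) =
      exchange-emerging h b u bs us h-here h-next b-here b-next u-here
    purple-row-exchange h (b ∷ bs) (u ∷ us) (entering-none h-here h-next (ord-here b-here b-next next-only))
                            (ord-skip u-here u-next us-ordered) =
      exchange-skip h b u bs us h-next b-next u-here u-next (purple-row-exchange (outflow b h u) bs us
        (entering-c (bit-outflow-of c b h u b-here h-here u-here) (bit-outflow-of (suc c) b h u b-next h-next u-next) next-only) us-ordered)
    purple-row-exchange h (b ∷ bs) (u ∷ us) (entering-none h-here h-next (ord-here b-here b-next next-only))
                            (ord-here u-here u-next us-next-only) =
      exchange-c-exits h b u bs us h-next b-next u-here u-next (bit-outflow-of c b h u b-here h-here u-here) next-only us-next-only
    purple-row-exchange h (b ∷ bs) (u ∷ us) (entering-c h-here h-next (next-skip _ _ _)) (ord-skip u-here u-next _) =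
      purple-exchange-vanish h b u bs us h-here h-next u-here u-next
    purple-row-exchange h (b ∷ bs) (u ∷ us) (entering-c h-here h-next (next-skip b-here b-next next-only))
                            (ord-here u-here u-next us-next-only) =
      exchange-c-exits h b u bs us h-next b-next u-here u-next (bit-outflow-of c b h u b-here h-here u-here) next-only us-next-only
    purple-row-exchange h (b ∷ bs) (u ∷ us) (entering-c h-here h-next (next-here _ _ _)) (ord-skip u-here u-next _) =
      purple-exchange-vanish h b u bs us h-here h-next u-here u-next
    purple-row-exchange h (b ∷ bs) (u ∷ us) (entering-c h-here h-next (next-here b-here b-next clear))
                            (ord-here u-here u-next us-next-only) =
      exchange-exit h b u bs us (bit-outflow-of c b h u b-here h-here u-here)
        (*-≡0ʳ (entry (suc c) (toN (outflow b h u))) (P.trans (entry-purpleμ c b h u) (cong₂ (λ p q → b2n p ∸ b2n q) u-here h-here)))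
        (Clear⇒Without-c clear) (NextOnly⇒Without-c us-next-only)
        (purple-weight-leaving (suc c) (sw b) (sw h) u _ (swapped-next h h-here) u-next)
        (purple-weight-leaving c b h (sw u) _ h-here (swapped-here u u-next))

  Z[]-≡ : ∀ {k w} (u v : Vec (Label k) w) → u ≡ v → Z R [] u v ≈ 1#
  Z[]-≡ u .u P.refl = reflexive (cong (ind R) (allEqL-refl u))

  Z[]-≢ : ∀ {k w} (u v : Vec (Label k) w) → u ≢ v → Z R [] u v ≈ 0#
  Z[]-≢ u v u≢v with allB (zipWith eqL u v) in equal
  ... | true  = ⊥-elim (u≢v (allEqL⇒≡ u v equal))
  ... | false = refl

  module Stacking {k : ℕ} (c : ℕ) (c+1<k : suc c < k) (t : Carrier) where
    open TwoColours c c+1<k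

    sws : ∀ {w} → Vec (Label k) w → Vec (Label k) w
    sws = swapColours c

    states : (w : ℕ) → List (Vec (Label k) w)
    states w = allVecs (allLabels k) w

    paired : ∀ {w} → (Vec (Label k) w → Carrier) → Vec (Label k) w → Carrier
    paired F u = if does (Ordered? u) then F u + F (sws u) else (if does (Ordered? (sws u)) then 0# else F u)

    ∑-paired : ∀ {w} (F : Vec (Label k) w → Carrier) → ∑ (states w) F ≈ ∑ (states w) (paired F)
    ∑-paired {w} F = begin
      ∑ (states w) F                                              ≈⟨ ∑-cong (states w) split ⟩
      ∑ (states w) (λ u → (A u + B u) + C u)                      ≈⟨ ∑-+ (states w) _ C ⟩
      ∑ (states w) (λ u → A u + B u) + ∑ (states w) C              ≈⟨ +-cong (∑-+ (states w) A B) refl ⟩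
      (∑ (states w) A + ∑ (states w) B) + ∑ (states w) C
        ≈⟨ +-cong (+-cong refl (∑-states-swapColours k c w B)) refl ⟨
      (∑ (states w) A + ∑ (states w) (λ u → B (sws u))) + ∑ (states w) C
        ≈⟨ +-cong (+-cong refl (∑-cong (states w) (λ u → reflexive (cong (λ v → if does (Ordered? v) then F (sws u) else 0#)
                                                                          (swapColours-involutive c u))))) refl ⟩
      (∑ (states w) A + ∑ (states w) A′) + ∑ (states w) C          ≈⟨ +-cong (∑-+ (states w) A A′) refl ⟨
      ∑ (states w) (λ u → A u + A′ u) + ∑ (states w) C             ≈⟨ ∑-+ (states w) _ C ⟨
      ∑ (states w) (λ u → (A u + A′ u) + C u)                     ≈⟨ ∑-cong (states w) merge ⟩
      ∑ (states w) (paired F)                                     ∎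
      where
      A B C A′ : Vec (Label k) w → Carrier
      A u  = if does (Ordered? u) then F u else 0#
      B u  = if does (Ordered? (sws u)) then F u else 0#
      C u  = if does (Ordered? u) then 0# else (if does (Ordered? (sws u)) then 0# else F u)
      A′ u = if does (Ordered? u) then F (sws u) else 0#
      split : ∀ u → F u ≈ (A u + B u) + C u
      split u with Ordered? u | Ordered? (sws u)
      ... | yes o | yes o′ = ⊥-elim (Ordered⇒¬Ordered-swapped o o′)
      ... | yes _ | no  _  = sym (trans (+-identityʳ _) (+-identityʳ _))
      ... | no  _ | yes _  = sym (trans (+-identityʳ _) (+-identityˡ _))
      ... | no  _ | no  _  = sym (trans (+-cong (+-identityʳ _) refl) (+-identityˡ _))
      merge : ∀ u → (A u + A′ u) + C u ≈ paired F u
      merge u with Ordered? u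
      ... | yes _ = +-identityʳ _
      ... | no  _ = trans (+-cong (+-identityˡ 0#) refl) (+-identityˡ _)

    ∑-states-by-pairs : ∀ {w} (F G : Vec (Label k) w → Carrier) →
                        (∀ u → Ordered u → F u + F (sws u) ≈ G u + G (sws u)) →
                        (∀ u → ¬ Ordered u → ¬ Ordered (sws u) → F u ≈ G u) →
                        ∑ (states w) F ≈ ∑ (states w) G
    ∑-states-by-pairs {w} F G ordered unordered =
      trans (∑-paired F) (trans (∑-cong (states w) pairwise) (sym (∑-paired G)))
      where
      pairwise : ∀ u → paired F u ≈ paired G u
      pairwise u with Ordered? u | Ordered? (sws u)
      ... | yes o  | _      = ordered u o
      ... | no  _  | yes _  = refl
      ... | no ¬o  | no ¬o′ = unordered u ¬o ¬o′

    empty : Label k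
    empty = replicate k false

    record RowExchanges (V : VWeight R k) : Set (r ⊔ ℓ) where
      field
        tied : ∀ {w} (M u : Vec (Label k) w) → Tied M → Ordered u → t * rowW R V empty M u ≈ rowW R V empty M (sws u)
        ordered : ∀ {w} (M u : Vec (Label k) w) → Ordered M → Ordered u →
                  t * rowW R V empty M u + t * (t * rowW R V empty (sws M) u)
                  ≈ rowW R V empty M (sws u) + t * rowW R V empty (sws M) (sws u)
        unbalanced : ∀ {w} j (M u : Vec (Label k) w) → count j M ≢ count j u → rowW R V empty M u ≈ 0#

    record Exchange {w} (Vs : List (VWeight R k)) (T : Vec (Label k) w) : Set (r ⊔ ℓ) where
      field
        tied : ∀ u → Tied u → t * Z R Vs u T ≈ Z R Vs u (sws T)
        ordered : ∀ u → Ordered u → t * Z R Vs u T + t * (t * Z R Vs (sws u) T) ≈ Z R Vs u (sws T) + t * Z R Vs (sws u) (sws T)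
        unbalanced : ∀ u → ¬ OnceEach u → t * Z R Vs u T ≈ Z R Vs u (sws T)

      unordered : ∀ u → ¬ Ordered u → ¬ Ordered (sws u) → t * Z R Vs u T ≈ Z R Vs u (sws T)
      unordered u ¬o ¬o′ with unordered⇒Tied⊎¬OnceEach u ¬o ¬o′
      ... | inj₁ tied-u    = tied u tied-u
      ... | inj₂ ¬once-each = unbalanced u ¬once-each

    exchange-no-rows : ∀ {w} (T : Vec (Label k) w) → Ordered T → Exchange [] T
    exchange-no-rows T T-ordered = record { tied = tied ; ordered = ordered ; unbalanced = unbalanced }
      where
      T′-ordered : ∀ {u} → u ≡ sws T → Ordered (sws u)
      T′-ordered P.refl = P.subst Ordered (P.sym (swapColours-involutive c T)) T-ordered
      tied : ∀ u → Tied u → t * Z R [] u T ≈ Z R [] u (sws T)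
      tied u tied-u = trans (*-cong refl (Z[]-≢ u T (λ { P.refl → Ordered⇒¬Tied T-ordered tied-u })))
        (trans (zeroʳ t) (sym (Z[]-≢ u (sws T) (λ e → Ordered⇒¬Tied (P.subst Ordered (Tied-fixed tied-u) (T′-ordered e)) tied-u))))
      unbalanced : ∀ u → ¬ OnceEach u → t * Z R [] u T ≈ Z R [] u (sws T)
      unbalanced u ¬once-each =
        trans (*-cong refl (Z[]-≢ u T (λ { P.refl → ¬once-each (Ordered-count T-ordered) })))
          (trans (zeroʳ t) (sym (Z[]-≢ u (sws T) (λ { P.refl → ¬once-each (Ordered-swapped-count T-ordered) }))))
      ordered : ∀ u → Ordered u → t * Z R [] u T + t * (t * Z R [] (sws u) T) ≈ Z R [] u (sws T) + t * Z R [] (sws u) (sws T)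
      ordered u u-ordered = begin
        t * Z R [] u T + t * (t * Z R [] (sws u) T)
          ≈⟨ +-cong refl (*-cong refl (*-cong refl (Z[]-≢ (sws u) T (λ { P.refl → Ordered⇒¬Ordered-swapped u-ordered T-ordered })))) ⟩
        t * Z R [] u T + t * (t * 0#)
          ≈⟨ solve 2 (λ t z → t :* z :+ t :* (t :* con 0) := con 0 :+ t :* z) refl t (Z R [] u T) ⟩
        0# + t * Z R [] u T
          ≈⟨ +-cong (Z[]-≢ u (sws T) (λ { P.refl → Ordered⇒¬Ordered-swapped T-ordered u-ordered })) (*-cong refl swapped-both) ⟨
        Z R [] u (sws T) + t * Z R [] (sws u) (sws T) ∎
        where
        swapped-both : Z R [] (sws u) (sws T) ≈ Z R [] u T
        swapped-both with Vecₚ.≡-dec (Vecₚ.≡-dec Boolₚ._≟_) u T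
        ... | yes u≡T = trans (Z[]-≡ (sws u) (sws T) (cong sws u≡T)) (sym (Z[]-≡ u T u≡T))
        ... | no  u≢T = trans (Z[]-≢ (sws u) (sws T) (λ e → u≢T (swapColours-injective c u T e))) (sym (Z[]-≢ u T u≢T))

    private
      tied-summands : ∀ k₁ k₂ a b a′ b′ → t * k₁ ≈ k₂ → t * a + t * (t * b) ≈ a′ + t * b′ →
                      t * (k₁ * a) + t * (k₂ * b) ≈ k₁ * a′ + k₂ * b′
      tied-summands k₁ k₂ a b a′ b′ e₁ e₂ = begin
        t * (k₁ * a) + t * (k₂ * b)       ≈⟨ +-cong refl (*-cong refl (*-cong e₁ refl)) ⟨
        t * (k₁ * a) + t * ((t * k₁) * b)
          ≈⟨ solve 4 (λ t k a b → t :* (k :* a) :+ t :* ((t :* k) :* b) := k :* (t :* a :+ t :* (t :* b))) refl t k₁ a b ⟩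
        k₁ * (t * a + t * (t * b))        ≈⟨ *-cong refl e₂ ⟩
        k₁ * (a′ + t * b′)
          ≈⟨ solve 4 (λ t k a b → k :* (a :+ t :* b) := k :* a :+ (t :* k) :* b) refl t k₁ a′ b′ ⟩
        k₁ * a′ + (t * k₁) * b′           ≈⟨ +-cong refl (*-cong e₁ refl) ⟩
        k₁ * a′ + k₂ * b′                 ∎

      ordered-summands : ∀ k₁ k₂ k₃ k₄ a b a′ b′ → t * k₁ + t * (t * k₂) ≈ k₃ + t * k₄ →
                         t * a + t * (t * b) ≈ a′ + t * b′ →
                         (t * (k₁ * a) + t * (t * (k₂ * a))) + (t * (k₃ * b) + t * (t * (k₄ * b)))
                         ≈ (k₁ * a′ + t * (k₂ * a′)) + (k₃ * b′ + t * (k₄ * b′))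
      ordered-summands k₁ k₂ k₃ k₄ a b a′ b′ e₁ e₂ = begin
        (t * (k₁ * a) + t * (t * (k₂ * a))) + (t * (k₃ * b) + t * (t * (k₄ * b)))
          ≈⟨ solve 7 (λ t k₁ k₂ k₃ k₄ a b → (t :* (k₁ :* a) :+ t :* (t :* (k₂ :* a))) :+ (t :* (k₃ :* b) :+ t :* (t :* (k₄ :* b)))
                       := (k₁ :+ t :* k₂) :* (t :* a) :+ (k₃ :+ t :* k₄) :* (t :* b)) refl t k₁ k₂ k₃ k₄ a b ⟩
        K * (t * a) + (k₃ + t * k₄) * (t * b)   ≈⟨ +-cong refl (*-cong tK≈ refl) ⟨
        K * (t * a) + (t * K) * (t * b)
          ≈⟨ solve 4 (λ t X a b → X :* (t :* a) :+ (t :* X) :* (t :* b) := X :* (t :* a :+ t :* (t :* b))) refl t K a b ⟩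
        K * (t * a + t * (t * b))               ≈⟨ *-cong refl e₂ ⟩
        K * (a′ + t * b′)
          ≈⟨ solve 4 (λ t X a b → X :* (a :+ t :* b) := X :* a :+ (t :* X) :* b) refl t K a′ b′ ⟩
        K * a′ + (t * K) * b′                   ≈⟨ +-cong refl (*-cong tK≈ refl) ⟩
        K * a′ + (k₃ + t * k₄) * b′
          ≈⟨ solve 7 (λ t k₁ k₂ k₃ k₄ a b → (k₁ :+ t :* k₂) :* a :+ (k₃ :+ t :* k₄) :* b
                       := (k₁ :* a :+ t :* (k₂ :* a)) :+ (k₃ :* b :+ t :* (k₄ :* b))) refl t k₁ k₂ k₃ k₄ a′ b′ ⟩
        (k₁ * a′ + t * (k₂ * a′)) + (k₃ * b′ + t * (k₄ * b′)) ∎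
        where
        K = k₁ + t * k₂
        tK≈ : t * K ≈ k₃ + t * k₄
        tK≈ = trans (distribˡ t k₁ (t * k₂)) e₁

      unordered-summand : ∀ k a a′ → t * a ≈ a′ → t * (k * a) ≈ k * a′
      unordered-summand k a a′ e = trans (solve 3 (λ t k a → t :* (k :* a) := k :* (t :* a)) refl t k a) (*-cong refl e)

    exchange-add-row : ∀ {w} (V : VWeight R k) (Vs : List (VWeight R k)) (T : Vec (Label k) w) →
                       RowExchanges V → Exchange Vs T → Exchange (V ∷ Vs) T
    exchange-add-row {w} V Vs T row-exchanges exchange = record { tied = tied ; ordered = ordered ; unbalanced = unbalanced }
      where
      module Row = RowExchanges row-exchanges
      module Rest = Exchange exchange
      K : Vec (Label k) w → Vec (Label k) w → Carrier
      K M u = rowW R V empty M u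
      a a′ : Vec (Label k) w → Carrier
      a u  = Z R Vs u T
      a′ u = Z R Vs u (sws T)
      t∑ : ∀ (f : Vec (Label k) w → Carrier) → t * ∑ (states w) f ≈ ∑ (states w) (λ u → t * f u)
      t∑ f = sym (∑-*ˡ (states w) t f)
      unordered : ∀ M u → ¬ Ordered u → ¬ Ordered (sws u) → t * (K M u * a u) ≈ K M u * a′ u
      unordered M u ¬o ¬o′ = unordered-summand (K M u) (a u) (a′ u) (Rest.unordered u ¬o ¬o′)

      tied : ∀ M → Tied M → t * Z R (V ∷ Vs) M T ≈ Z R (V ∷ Vs) M (sws T)
      tied M tied-M = trans (t∑ _) (∑-states-by-pairs _ _
        (λ u u-ordered → tied-summands (K M u) (K M (sws u)) (a u) (a (sws u)) (a′ u) (a′ (sws u))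
                           (Row.tied M u tied-M u-ordered) (Rest.ordered u u-ordered))
        (unordered M))

      unbalanced : ∀ M → ¬ OnceEach M → t * Z R (V ∷ Vs) M T ≈ Z R (V ∷ Vs) M (sws T)
      unbalanced M ¬once-each = trans (t∑ _) (∑-states-by-pairs _ _ pairs (unordered M))
        where
        K≈0 : ∀ u → OnceEach u → K M u ≈ 0#
        K≈0 u (once-c , once-c+1) with count c M ≟ 1
        ... | no  M≢1 = Row.unbalanced c M u (λ e → M≢1 (P.trans e once-c))
        ... | yes M≡1 = Row.unbalanced (suc c) M u (λ e → ¬once-each (M≡1 , P.trans e once-c+1))
        pairs : ∀ u → Ordered u → t * (K M u * a u) + t * (K M (sws u) * a (sws u)) ≈ K M u * a′ u + K M (sws u) * a′ (sws u)
        pairs u u-ordered = begin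
          t * (K M u * a u) + t * (K M (sws u) * a (sws u))
            ≈⟨ +-cong (*-cong refl (zero-*ˡ K≈0₁)) (*-cong refl (zero-*ˡ K≈0₂)) ⟩
          t * 0# + t * 0#                                      ≈⟨ +-cong (zeroʳ t) (zeroʳ t) ⟩
          0# + 0#                                              ≈⟨ +-cong (zero-*ˡ K≈0₁) (zero-*ˡ K≈0₂) ⟨
          K M u * a′ u + K M (sws u) * a′ (sws u)              ∎
          where
          K≈0₁ = K≈0 u (Ordered-count u-ordered)
          K≈0₂ = K≈0 (sws u) (Ordered-swapped-count u-ordered)

      ordered : ∀ M → Ordered M → t * Z R (V ∷ Vs) M T + t * (t * Z R (V ∷ Vs) (sws M) T)
                                  ≈ Z R (V ∷ Vs) M (sws T) + t * Z R (V ∷ Vs) (sws M) (sws T)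
      ordered M M-ordered = begin
        t * Z R (V ∷ Vs) M T + t * (t * Z R (V ∷ Vs) (sws M) T)
          ≈⟨ +-cong (t∑ _) (trans (*-cong refl (t∑ _)) (t∑ _)) ⟩
        ∑ (states w) (λ u → t * (K M u * a u)) + ∑ (states w) (λ u → t * (t * (K (sws M) u * a u)))
          ≈⟨ ∑-+ (states w) _ _ ⟨
        ∑ (states w) (λ u → t * (K M u * a u) + t * (t * (K (sws M) u * a u)))
          ≈⟨ ∑-states-by-pairs _ _
               (λ u u-ordered → ordered-summands (K M u) (K (sws M) u) (K M (sws u)) (K (sws M) (sws u))
                                  (a u) (a (sws u)) (a′ u) (a′ (sws u)) (Row.ordered M u M-ordered u-ordered) (Rest.ordered u u-ordered))
               (λ u ¬o ¬o′ → +-cong (unordered M u ¬o ¬o′) (*-cong refl (unordered (sws M) u ¬o ¬o′))) ⟩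
        ∑ (states w) (λ u → K M u * a′ u + t * (K (sws M) u * a′ u))
          ≈⟨ ∑-+ (states w) _ _ ⟩
        ∑ (states w) (λ u → K M u * a′ u) + ∑ (states w) (λ u → t * (K (sws M) u * a′ u))
          ≈⟨ +-cong refl (∑-*ˡ (states w) t _) ⟩
        Z R (V ∷ Vs) M (sws T) + t * Z R (V ∷ Vs) (sws M) (sws T) ∎

    exchange-rows : ∀ {w} (Vs : List (VWeight R k)) (T : Vec (Label k) w) → All RowExchanges Vs → Ordered T → Exchange Vs T
    exchange-rows []       T []       T-ordered = exchange-no-rows T T-ordered
    exchange-rows (V ∷ Vs) T (p ∷ ps) T-ordered = exchange-add-row V Vs T p (exchange-rows Vs T ps T-ordered)

  module AdjacentSwap {k : ℕ} (c : ℕ) (c+1<k : suc c < k) (t : Carrier) where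
    open TwoColours c c+1<k
    open Stacking c c+1<k t

    private
      empty-here : bit c empty ≡ false
      empty-here = bit-replicate-false k c

      empty-next : bit (suc c) empty ≡ false
      empty-next = bit-replicate-false k (suc c)

      empty-unbalanced : ∀ {w} j (M u : Vec (Label k) w) → count j M ≢ count j u → b2n (bit j empty) +ℕ count j M ≢ count j u
      empty-unbalanced j M u M≢u e = M≢u (P.trans (cong (λ b → b2n b +ℕ count j M) (P.sym (bit-replicate-false k j))) e)

      empty-fixed : swapAt c empty ≡ empty
      empty-fixed = swapAt-replicate k c false

    white-row-exchanges : ∀ x → RowExchanges (White R {k} t x)
    white-row-exchanges x = record
      { tied       = λ M u → tied-exchange empty M u empty-here empty-next
      ; ordered    = λ M u M-ordered u-ordered → P.subst (λ h → t * row empty M u + t * (t * row h (sws M) u)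
                                                            ≈ row empty M (sws u) + t * row h (sws M) (sws u))
                       empty-fixed (white-row-exchange empty M u (entering-none empty-here empty-next M-ordered) u-ordered)
      ; unbalanced = λ j M u M≢u → row-unbalanced j empty M u (empty-unbalanced j M u M≢u)
      }
      where open WhiteRow t x c c+1<k hiding (sws)

    purple-row-exchanges : ∀ x → RowExchanges (Purple R {k} t x)
    purple-row-exchanges x = record
      { tied       = λ M u → tied-exchange empty M u empty-here empty-next
      ; ordered    = λ M u M-ordered u-ordered → P.subst (λ h → t * row empty M u + t * (t * row h (sws M) u)
                                                            ≈ row empty M (sws u) + t * row h (sws M) (sws u))
                       empty-fixed (purple-row-exchange empty M u (entering-none empty-here empty-next M-ordered) u-ordered)
      ; unbalanced = λ j M u M≢u → row-unbalanced j empty M u (empty-unbalanced j M u M≢u)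
      }
      where open PurpleRow t x c c+1<k hiding (sws)

    rowsS-exchanges : ∀ {n m} (xs : Vec Carrier n) (ys : Vec Carrier m) → All RowExchanges (rowsS R t xs ys)
    rowsS-exchanges xs ys = ++⁺ (whites xs) (purples ys)
      where
      whites : ∀ {n} (xs : Vec Carrier n) → All RowExchanges (toList (mapV (White R {k} t) xs))
      whites []       = []
      whites (x ∷ xs) = white-row-exchanges x ∷ whites xs
      purples : ∀ {m} (ys : Vec Carrier m) → All RowExchanges (toList (mapV (Purple R {k} t) ys))
      purples []       = []
      purples (y ∷ ys) = purple-row-exchanges y ∷ purples ys

    bottomB-tied : ∀ N → Tied (bottomB R k N)
    bottomB-tied N = tied-here (bit-replicate k c true (ℕₚ.<-trans (ℕₚ.n<1+n c) c+1<k)) (bit-replicate k (suc c) true c+1<k)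
                               (Clear-empty (suc N))

    topB-ordered : ∀ N (lam : Vec ℕ k) → entry c lam < entry (suc c) lam → entry (suc c) lam < suc (suc N) →
                   Ordered (topB R N lam)
    topB-ordered N lam a<b b<N+2 = P.subst Ordered (P.sym (tabulate-columnsFrom lam 0 (suc (suc N))))
      (TopColumns.Ordered-columnsFrom c c+1<k lam 0 (suc (suc N)) z≤n a<b b<N+2)

    swapColours-topB : ∀ N (lam : Vec ℕ k) → sws (topB R N lam) ≡ topB R N (swapAt c lam)
    swapColours-topB N lam =
      P.trans (cong sws (tabulate-columnsFrom lam 0 (suc (suc N))))
        (P.trans (swapColours-columnsFrom c lam 0 (suc (suc N))) (P.sym (tabulate-columnsFrom (swapAt c lam) 0 (suc (suc N)))))

    LS-swapAt : ∀ {n m} N (lam : Vec ℕ k) → entry c lam < entry (suc c) lam → entry (suc c) lam < suc (suc N) →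
                (xs : Vec Carrier n) (ys : Vec Carrier m) → t * LS R N lam xs ys t ≈ LS R N (swapAt c lam) xs ys t
    LS-swapAt N lam a<b b<N+2 xs ys =
      P.subst (λ T → t * LS R N lam xs ys t ≈ Z R (rowsS R t xs ys) (bottomB R k N) T) (swapColours-topB N lam)
        (Exchange.tied (exchange-rows (rowsS R t xs ys) (topB R N lam) (rowsS-exchanges xs ys) (topB-ordered N lam a<b b<N+2))
                       (bottomB R k N) (bottomB-tied N))

-- Rearrangements and sorting

transposeAt : ℕ → ∀ {k} → Fin k → Fin k
transposeAt zero    {suc zero}    Fin.zero             = Fin.zero
transposeAt zero    {suc (suc k)} Fin.zero             = Fin.suc Fin.zero
transposeAt zero    {suc (suc k)} (Fin.suc Fin.zero)   = Fin.zero
transposeAt zero    {suc (suc k)} (Fin.suc (Fin.suc i)) = Fin.suc (Fin.suc i)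
transposeAt (suc c) Fin.zero                           = Fin.zero
transposeAt (suc c) (Fin.suc i)                        = Fin.suc (transposeAt c i)

transposeAt-involutive : ∀ c {k} (i : Fin k) → transposeAt c (transposeAt c i) ≡ i
transposeAt-involutive zero    {suc zero}    Fin.zero              = P.refl
transposeAt-involutive zero    {suc (suc k)} Fin.zero              = P.refl
transposeAt-involutive zero    {suc (suc k)} (Fin.suc Fin.zero)    = P.refl
transposeAt-involutive zero    {suc (suc k)} (Fin.suc (Fin.suc i)) = P.refl
transposeAt-involutive (suc c) Fin.zero                            = P.refl
transposeAt-involutive (suc c) (Fin.suc i)                         = cong Fin.suc (transposeAt-involutive c i)

lookup-swapAt : ∀ {a} {A : Set a} {k} c (v : Vec A k) (i : Fin k) → lookup (swapAt c v) i ≡ lookup v (transposeAt c i)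
lookup-swapAt zero    (x ∷ [])    Fin.zero              = P.refl
lookup-swapAt zero    (x ∷ y ∷ v) Fin.zero              = P.refl
lookup-swapAt zero    (x ∷ y ∷ v) (Fin.suc Fin.zero)    = P.refl
lookup-swapAt zero    (x ∷ y ∷ v) (Fin.suc (Fin.suc i)) = P.refl
lookup-swapAt (suc c) (x ∷ v)     Fin.zero              = P.refl
lookup-swapAt (suc c) (x ∷ v)     (Fin.suc i)           = lookup-swapAt c v i

transposition : ∀ {k} → ℕ → Permutation′ k
transposition c = permutation (transposeAt c) (transposeAt c) (transposeAt-involutive c) (transposeAt-involutive c)

Rearrangement : ∀ {k} → Vec ℕ k → Vec ℕ k → Set
Rearrangement {k} lam nu = Σ[ π ∈ Permutation′ k ] (∀ i → lookup nu i ≡ lookup lam (π ⟨$⟩ʳ i))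

Rearrangement-sym : ∀ {k} {lam nu : Vec ℕ k} → Rearrangement lam nu → Rearrangement nu lam
Rearrangement-sym {lam = lam} (π , nu≡lam∘π) =
  flip π , λ i → P.sym (P.trans (nu≡lam∘π (π ⟨$⟩ˡ i)) (cong (lookup lam) (inverseʳ π)))

Rearrangement-swapAtˡ : ∀ {k} c {lam nu : Vec ℕ k} → Rearrangement lam nu → Rearrangement (swapAt c lam) nu
Rearrangement-swapAtˡ c {lam} (π , nu≡lam∘π) = π ∘ₚ transposition c , λ i →
  P.trans (nu≡lam∘π i) (P.trans (cong (lookup lam) (P.sym (transposeAt-involutive c _))) (P.sym (lookup-swapAt c lam _)))

Rearrangement-swapAtʳ : ∀ {k} c {lam nu : Vec ℕ k} → Rearrangement lam nu → Rearrangement lam (swapAt c nu)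
Rearrangement-swapAtʳ c {nu = nu} (π , nu≡lam∘π) = transposition c ∘ₚ π , λ i →
  P.trans (lookup-swapAt c nu i) (nu≡lam∘π (transposeAt c i))

data Sorted : ∀ {k} → Vec ℕ k → Set where
  sorted[]  : Sorted []
  sorted[-] : ∀ {x} → Sorted (x ∷ [])
  sorted∷   : ∀ {k x y} {v : Vec ℕ k} → x ≤ y → Sorted (y ∷ v) → Sorted (x ∷ y ∷ v)

Sorted-monotone : ∀ {k} {v : Vec ℕ k} → Sorted v → ∀ (i j : Fin k) → toℕ i ≤ toℕ j → lookup v i ≤ lookup v j
Sorted-monotone sorted[-]         Fin.zero    Fin.zero    _       = ℕₚ.≤-refl
Sorted-monotone (sorted∷ x≤y s)   Fin.zero    Fin.zero    _       = ℕₚ.≤-refl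
Sorted-monotone (sorted∷ x≤y s)   Fin.zero    (Fin.suc j) _       = ℕₚ.≤-trans x≤y (Sorted-monotone s Fin.zero j z≤n)
Sorted-monotone (sorted∷ x≤y s)   (Fin.suc i) (Fin.suc j) (s≤s i≤j) = Sorted-monotone s i j i≤j

sorted-rearrangement-≤ : ∀ {k} {lam nu : Vec ℕ k} → Sorted lam → Sorted nu → Rearrangement lam nu →
                         ∀ i → lookup lam i ≤ lookup nu i
sorted-rearrangement-≤ {lam = lam} {nu} lam-sorted nu-sorted (π , nu≡lam∘π) i
  with Finₚ.injective⇒existsPivot (λ {x} {y} e → P.trans (P.sym (inverseˡ π)) (P.trans (cong (π ⟨$⟩ˡ_) e) (inverseˡ π))) i
... | j , j≤i , i≤πj = ℕₚ.≤-trans (Sorted-monotone lam-sorted i (π ⟨$⟩ʳ j) i≤πj)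
                         (P.subst (_≤ lookup nu i) (nu≡lam∘π j) (Sorted-monotone nu-sorted j i j≤i))

sorted-rearrangement-≡ : ∀ {k} {lam nu : Vec ℕ k} → Sorted lam → Sorted nu → Rearrangement lam nu → lam ≡ nu
sorted-rearrangement-≡ {lam = lam} {nu} lam-sorted nu-sorted re =
  P.trans (P.sym (Vecₚ.tabulate∘lookup lam)) (P.trans (Vecₚ.tabulate-cong pointwise) (Vecₚ.tabulate∘lookup nu))
  where
  pointwise : ∀ i → lookup lam i ≡ lookup nu i
  pointwise i = ℕₚ.≤-antisym (sorted-rearrangement-≤ lam-sorted nu-sorted re i)
                             (sorted-rearrangement-≤ nu-sorted lam-sorted (Rearrangement-sym {lam = lam} {nu} re) i)

Descent : ∀ {k} → Vec ℕ k → Set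
Descent {k} v = Σ[ c ∈ ℕ ] (suc c < k × entry (suc c) v < entry c v)

descent-or-sorted : ∀ {k} (v : Vec ℕ k) → Descent v ⊎ Sorted v
descent-or-sorted []          = inj₂ sorted[]
descent-or-sorted (x ∷ [])    = inj₂ sorted[-]
descent-or-sorted (x ∷ y ∷ v) with y <? x | descent-or-sorted (y ∷ v)
... | yes y<x | _                    = inj₁ (0 , s≤s (s≤s z≤n) , y<x)
... | no  _   | inj₁ (c , c+1<k , d) = inj₁ (suc c , s≤s c+1<k , d)
... | no  y≮x | inj₂ sorted         = inj₂ (sorted∷ (ℕₚ.≮⇒≥ y≮x) sorted)

swapAt-descent : ∀ {k} c (v : Vec ℕ k) → suc c < k → entry (suc c) v < entry c v →
                 entry c (swapAt c v) < entry (suc c) (swapAt c v)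
swapAt-descent zero    (x ∷ [])    (s≤s ())  d
swapAt-descent zero    (x ∷ y ∷ v) _         d = d
swapAt-descent (suc c) (x ∷ v)     (s≤s c+1<k) d = swapAt-descent c v c+1<k d

<⇒<ᵇ-true : ∀ {m n} → m < n → (m <ᵇ n) ≡ true
<⇒<ᵇ-true {m} {n} m<n with m <ᵇ n in e
... | true  = P.refl
... | false = ⊥-elim (P.subst T e (ℕₚ.<⇒<ᵇ m<n))

≥⇒<ᵇ-false : ∀ {m n} → n ≤ m → (m <ᵇ n) ≡ false
≥⇒<ᵇ-false {m} {n} n≤m with m <ᵇ n in e
... | false = P.refl
... | true  = ⊥-elim (ℕₚ.<⇒≱ (ℕₚ.<ᵇ⇒< m n (P.subst T (P.sym e) tt)) n≤m)

Inv-swapAt-descent : ∀ {k} c (v : Vec ℕ k) → suc c < k → entry (suc c) v < entry c v → Inv v ≡ suc (Inv (swapAt c v))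
Inv-swapAt-descent zero    (x ∷ [])    (s≤s ()) d
Inv-swapAt-descent zero    (x ∷ y ∷ v) _        d rewrite <⇒<ᵇ-true d | ≥⇒<ᵇ-false (ℕₚ.<⇒≤ d) =
  cong suc (+-exchange (count> x v) (count> y v) (Inv v))
Inv-swapAt-descent (suc c) (x ∷ v) (s≤s c+1<k) d rewrite Inv-swapAt-descent c v c+1<k d | count>-swapAt x c v =
  ℕₚ.+-suc (count> x v) _

count>-≡0 : ∀ {k} r (v : Vec ℕ k) → (∀ i → r ≤ lookup v i) → count> r v ≡ 0
count>-≡0 r []      r≤ = P.refl
count>-≡0 r (x ∷ v) r≤ rewrite ≥⇒<ᵇ-false (r≤ Fin.zero) = count>-≡0 r v (λ i → r≤ (Fin.suc i))

Sorted⇒Inv≡0 : ∀ {k} {v : Vec ℕ k} → Sorted v → Inv v ≡ 0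
Sorted⇒Inv≡0 sorted[]                          = P.refl
Sorted⇒Inv≡0 sorted[-]                         = P.refl
Sorted⇒Inv≡0 {v = x ∷ y ∷ v} (sorted∷ x≤y s) =
  cong₂ _+ℕ_ (count>-≡0 x (y ∷ v) (λ i → Sorted-monotone (sorted∷ x≤y s) Fin.zero (Fin.suc i) z≤n)) (Sorted⇒Inv≡0 s)

entry-≤ : ∀ {k} B (v : Vec ℕ k) → (∀ i → lookup v i ≤ B) → ∀ j → entry j v ≤ B
entry-≤ B []      v≤B j       = z≤n
entry-≤ B (x ∷ v) v≤B zero    = v≤B Fin.zero
entry-≤ B (x ∷ v) v≤B (suc j) = entry-≤ B v (λ i → v≤B (Fin.suc i)) j

module BubbleSort {r ℓ} (R : CommutativeRing r ℓ) {k : ℕ} (t : CommutativeRing.Carrier R) (B : ℕ)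
  (Φ : Vec ℕ k → CommutativeRing.Carrier R)
  (Φ-swapAt : ∀ c → suc c < k → ∀ v → (∀ i → lookup v i ≤ B) → entry c v < entry (suc c) v →
              CommutativeRing._≈_ R (CommutativeRing._*_ R t (Φ v)) (Φ (swapAt c v))) where
  open CommutativeRing R
  open import Relation.Binary.Reasoning.Setoid setoid
  open import Algebra.Properties.CommutativeSemigroup *-commutativeSemigroup using (x∙yz≈y∙xz)

  Bounded : Vec ℕ k → Set
  Bounded v = ∀ i → lookup v i ≤ B

  Bounded-swapAt : ∀ c {v} → Bounded v → Bounded (swapAt c v)
  Bounded-swapAt c {v} v≤B i = P.subst (_≤ B) (P.sym (lookup-swapAt c v i)) (v≤B (transposeAt c i))

  Φ-descent : ∀ c → suc c < k → ∀ v → Bounded v → entry (suc c) v < entry c v → t * Φ (swapAt c v) ≈ Φ v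
  Φ-descent c c+1<k v v≤B d = trans (Φ-swapAt c c+1<k (swapAt c v) (Bounded-swapAt c v≤B) (swapAt-descent c v c+1<k d))
                                    (reflexive (cong Φ (swapAt-involutive c v)))

  private
    rearrange-within : ∀ n (lam nu : Vec ℕ k) → Inv lam +ℕ Inv nu < n → Bounded lam → Bounded nu → Rearrangement lam nu →
                       pow R t (Inv nu) * Φ lam ≈ pow R t (Inv lam) * Φ nu
    rearrange-within zero lam nu ()
    rearrange-within (suc n) lam nu fuel lam≤B nu≤B re with descent-or-sorted lam | descent-or-sorted nu
    ... | inj₁ (c , c+1<k , d) | _ = begin
      pow R t (Inv nu) * Φ lam          ≈⟨ *-cong refl (Φ-descent c c+1<k lam lam≤B d) ⟨
      pow R t (Inv nu) * (t * Φ mu)     ≈⟨ x∙yz≈y∙xz _ t _ ⟩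
      t * (pow R t (Inv nu) * Φ mu)     ≈⟨ *-cong refl (rearrange-within n mu nu fuel′ (Bounded-swapAt c lam≤B) nu≤B
                                                         (Rearrangement-swapAtˡ c {lam} {nu} re)) ⟩
      t * (pow R t (Inv mu) * Φ nu)     ≈⟨ *-assoc _ _ _ ⟨
      pow R t (suc (Inv mu)) * Φ nu     ≡⟨ cong (λ e → pow R t e * Φ nu) (Inv-swapAt-descent c lam c+1<k d) ⟨
      pow R t (Inv lam) * Φ nu          ∎
      where
      mu = swapAt c lam
      fuel′ : Inv mu +ℕ Inv nu < n
      fuel′ = ℕₚ.≤-pred (P.subst (λ e → e +ℕ Inv nu < suc n) (Inv-swapAt-descent c lam c+1<k d) fuel)
    ... | inj₂ _ | inj₁ (c , c+1<k , d) = begin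
      pow R t (Inv nu) * Φ lam          ≡⟨ cong (λ e → pow R t e * Φ lam) (Inv-swapAt-descent c nu c+1<k d) ⟩
      pow R t (suc (Inv mu)) * Φ lam    ≈⟨ *-assoc _ _ _ ⟩
      t * (pow R t (Inv mu) * Φ lam)    ≈⟨ *-cong refl (rearrange-within n lam mu fuel′ lam≤B (Bounded-swapAt c nu≤B)
                                                         (Rearrangement-swapAtʳ c {lam} {nu} re)) ⟩
      t * (pow R t (Inv lam) * Φ mu)    ≈⟨ x∙yz≈y∙xz t _ _ ⟩
      pow R t (Inv lam) * (t * Φ mu)    ≈⟨ *-cong refl (Φ-descent c c+1<k nu nu≤B d) ⟩
      pow R t (Inv lam) * Φ nu          ∎
      where
      mu = swapAt c nu
      fuel′ : Inv lam +ℕ Inv mu < n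
      fuel′ = ℕₚ.≤-pred (P.subst (_< suc n) (ℕₚ.+-suc (Inv lam) (Inv mu))
                          (P.subst (λ e → Inv lam +ℕ e < suc n) (Inv-swapAt-descent c nu c+1<k d) fuel))
    ... | inj₂ lam-sorted | inj₂ nu-sorted rewrite sorted-rearrangement-≡ lam-sorted nu-sorted re = refl

  Φ-rearrange : ∀ (lam nu : Vec ℕ k) → Bounded lam → Bounded nu → Rearrangement lam nu →
                pow R t (Inv nu) * Φ lam ≈ pow R t (Inv lam) * Φ nu
  Φ-rearrange lam nu = rearrange-within (suc (Inv lam +ℕ Inv nu)) lam nu ℕₚ.≤-refl

proposition4p13 : ∀ {c ℓ} (R : CommutativeRing c ℓ) (k : ℕ) → 1 ≤ k →
    (lam : Vec ℕ k) (σ : Permutation′ k) (n m N : ℕ) →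
    (∀ (a : Fin k) → lookup lam a ≤ suc N) →
    (xs : Vec (CommutativeRing.Carrier R) n) (ys : Vec (CommutativeRing.Carrier R) m)
    (t : CommutativeRing.Carrier R) →
    CommutativeRing._≈_ R
      (CommutativeRing._*_ R (pow R t (Inv (tabulate (λ i → lookup lam (σ ⟨$⟩ʳ i)))))
        (LS R N lam xs ys t))
      (CommutativeRing._*_ R (pow R t (Inv lam))
        (LS R N (tabulate (λ i → lookup lam (σ ⟨$⟩ʳ i))) xs ys t))
proposition4p13 R k _ lam σ n m N lam≤N+1 xs ys t =
  Φ-rearrange lam nu lam≤N+1 nu≤N+1 (σ , λ i → Vecₚ.lookup∘tabulate _ i)
  where
  open BubbleSort R t (suc N) (λ v → LS R N v xs ys t)
    (λ c c+1<k v v≤N+1 a<b → AdjacentSwap.LS-swapAt R c c+1<k t N v a<b (s≤s (entry-≤ (suc N) v v≤N+1 (suc c))) xs ys)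
  nu : Vec ℕ k
  nu = tabulate (λ i → lookup lam (σ ⟨$⟩ʳ i))
  nu≤N+1 : Bounded nu
  nu≤N+1 i = P.subst (_≤ suc N) (P.sym (Vecₚ.lookup∘tabulate _ i)) (lam≤N+1 (σ ⟨$⟩ʳ i))
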